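{- For all positive integers $d,n$, $$\sum_{k=0}^{n}\Omega_k^{(n)}d^k=\sum_{k=1}^{n}\chi_k^{(n)}(1+d)^k.$$
   Context: Indexing matrices (for $n$): either the degenerate matrix $\left[\begin{smallmatrix}\infty\\ \infty\end{smallmatrix}\right]$, or a $2\times m$ matrix $A=[a_{ij}]$, $1\le m\le n$, with $a_{ij}\in[0,n-1]$, $a_{1j}<a_{1k}$ and $a_{2j}\le a_{2k}$ for $j<k$, $a_{2j}=a_{2k}$ with $j<k$ only if both are $0$, and $a_{1j}\ge a_{2j}$ for all $j$. The blob-rank is the number of columns containing a $0$ (degenerate: $0$); $\Omega_k^{(n)}$ is the number of indexing matrices for $n$ of blob-rank $k$. TL-diagrams on $n$ points: non-crossing perfect matchings of top points $1,\dots,n$ and bottom points $1',\dots,n'$ drawn as disjoint arcs in the strip $\mathbb{R}\times[0,1]$, up to isotopy; the left side is the unbounded complementary region containing points $(x,1/2)$ with $x$ very negative; an arc is exposed to the left side if it lies on its boundary. $\chi_k^{(n)}$ is the number of TL-diagrams on $n$ points with exactly $k$ arcs exposed to the left side. -}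

module Defs where

open import Data.Nat as ℕ using (ℕ; zero; suc; _+_; _*_; _^_)
import Data.Nat.Properties as ℕP
open import Data.Fin using (Fin; toℕ; _<_; _≤_)
open import Data.Fin.Properties using (_<?_; _≤?_; _≟_; all?; any?)
open import Data.Vec using (Vec; []; _∷_; lookup)
open import Data.List using (List; [_]; _∷_; map; concatMap; allFin; filter; length; upTo)
open import Data.Nat.ListAction using (sum)
open import Data.Product using (_×_; ∃; ∃-syntax)
open import Data.Sum using (_⊎_)
open import Data.Unit using (⊤; tt)
open import Relation.Nullary using (Dec; yes; ¬_; ¬?)
open import Relation.Nullary.Decidable using (_×-dec_; _⊎-dec_; _→-dec_)
open import Relation.Binary.PropositionalEquality using (_≡_; _≢_)

vecs : (k m : ℕ) → List (Vec (Fin k) m)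
vecs k zero    = [ [] ]
vecs k (suc m) = concatMap (λ x → map (x ∷_) (vecs k m)) (allFin k)

-- A candidate matrix: either the degenerate matrix [∞;∞], or a 2×m
-- matrix given by its first row r₁ and second row r₂, entries in
-- [0, n-1] (i.e. Fin n).
data Mat (n : ℕ) : Set where
  degenerate : Mat n
  cols       : (m : ℕ) → (r₁ r₂ : Vec (Fin n) m) → Mat n

IsIndexing : {n : ℕ} → Mat n → Set
IsIndexing degenerate = ⊤
IsIndexing {n} (cols m r₁ r₂) =
  (1 ℕ.≤ m) × (m ℕ.≤ n)
  × (∀ j k → j < k → lookup r₁ j < lookup r₁ k)
  × (∀ j k → j < k → lookup r₂ j ≤ lookup r₂ k)
  × (∀ j k → j < k → lookup r₂ j ≡ lookup r₂ k →
        (toℕ (lookup r₂ j) ≡ 0) × (toℕ (lookup r₂ k) ≡ 0))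
  × (∀ j → lookup r₂ j ≤ lookup r₁ j)

isIndexing? : {n : ℕ} → (A : Mat n) → Dec (IsIndexing A)
isIndexing? degenerate = yes tt
isIndexing? {n} (cols m r₁ r₂) =
  (1 ℕ.≤? m) ×-dec (m ℕ.≤? n)
  ×-dec all? (λ j → all? (λ k → (j <? k) →-dec (lookup r₁ j <? lookup r₁ k)))
  ×-dec all? (λ j → all? (λ k → (j <? k) →-dec (lookup r₂ j ≤? lookup r₂ k)))
  ×-dec all? (λ j → all? (λ k → (j <? k) →-dec ((lookup r₂ j ≟ lookup r₂ k) →-dec
            ((toℕ (lookup r₂ j) ℕ.≟ 0) ×-dec (toℕ (lookup r₂ k) ℕ.≟ 0)))))
  ×-dec all? (λ j → lookup r₂ j ≤? lookup r₁ j)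

blobRank : {n : ℕ} → Mat n → ℕ
blobRank degenerate = 0
blobRank (cols m r₁ r₂) =
  length (filter (λ j → (toℕ (lookup r₁ j) ℕ.≟ 0) ⊎-dec (toℕ (lookup r₂ j) ℕ.≟ 0))
                 (allFin m))

-- All candidate matrices with at most n columns (a finite list that
-- contains every indexing matrix for n exactly once).
allMats : (n : ℕ) → List (Mat n)
allMats n = degenerate ∷
  concatMap (λ m → concatMap (λ r₁ → map (cols m r₁) (vecs n m)) (vecs n m))
            (upTo (suc n))

Ω : (k n : ℕ) → ℕ
Ω k n = length (filter (λ A → isIndexing? A ×-dec (blobRank A ℕ.≟ k)) (allMats n))

-- The 2n boundary points are listed in their cyclic order around the
-- boundary of the strip region: position i (0 ≤ i < n) is the top point
-- i+1, position n+j (0 ≤ j < n) is the bottom point (n-j)'.  The left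
-- side of the strip corresponds to the gap between the last position
-- (bottom point 1') and the first position (top point 1).
-- A TL-diagram (an isotopy class of non-crossing perfect matchings) is
-- encoded as its matching: a fixed-point-free involution μ on the
-- positions with no two arcs interleaving.

Pos : ℕ → Set
Pos n = Fin (n + n)

IsTL : (n : ℕ) → Vec (Pos n) (n + n) → Set
IsTL n μ =
  (∀ i → lookup μ i ≢ i)
  × (∀ i → lookup μ (lookup μ i) ≡ i)
  × ¬ (∃[ i ] ∃[ j ] (i < j) × (j < lookup μ i) × (lookup μ i < lookup μ j))

isTL? : (n : ℕ) → (μ : Vec (Pos n) (n + n)) → Dec (IsTL n μ)
isTL? n μ =
  all? (λ i → ¬? (lookup μ i ≟ i))
  ×-dec all? (λ i → lookup μ (lookup μ i) ≟ i)
  ×-dec ¬? (any? (λ i → any? (λ j →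
          (i <? j) ×-dec (j <? lookup μ i) ×-dec (lookup μ i <? lookup μ j))))

-- The arc with left endpoint i (i < μ i) is exposed to the left side
-- iff it is not nested inside another arc: no j with j < i < μ i < μ j.
IsExposedLeftEnd : (n : ℕ) → Vec (Pos n) (n + n) → Pos n → Set
IsExposedLeftEnd n μ i =
  (i < lookup μ i) × ¬ (∃[ j ] (j < i) × (lookup μ i < lookup μ j))

isExposedLeftEnd? : (n : ℕ) → (μ : Vec (Pos n) (n + n)) → (i : Pos n) →
                    Dec (IsExposedLeftEnd n μ i)
isExposedLeftEnd? n μ i =
  (i <? lookup μ i) ×-dec ¬? (any? (λ j → (j <? i) ×-dec (lookup μ i <? lookup μ j)))

exposed : (n : ℕ) → Vec (Pos n) (n + n) → ℕ
exposed n μ = length (filter (isExposedLeftEnd? n μ) (allFin (n + n)))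

χ : (k n : ℕ) → ℕ
χ k n = length (filter (λ μ → isTL? n μ ×-dec (exposed n μ ℕ.≟ k))
                       (vecs (n + n) (n + n)))

sumFromTo : ℕ → ℕ → (ℕ → ℕ) → ℕ
sumFromTo a b f = sum (map (λ i → f (a + i)) (upTo (suc b ℕ.∸ a)))

module Submission where

-- Both sides are weighted counts of ±1 lattice paths of length 2n that never go below 0.
-- A TL-diagram is the Dyck word of its arc openers (up) and closers (down) read left to right,
-- and its arcs exposed to the left side are its up steps taken at height 0: the right side is
-- the sum over Dyck words of (1 + d) ^ (number of returns to 0).
-- Scanning the values 0, 1, …, n - 1 in turn, an indexing matrix of blob-rank k is a bicoloured
-- Motzkin path whose height counts the columns still waiting for their top entry, starting with
-- the k zero columns; doubling its steps shows that Ω_k counts the paths from height 2k down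
-- to 0, i.e. from 0 up to 2k. Turning the last up steps from the heights 1, 3, …, 2k - 1 into
-- down steps makes these the Dyck paths with k marked returns to 0, whence a factor 1 + d per return.

open import Defs
open import Data.Bool as Bool using (Bool; true; false; _∧_; _∨_; T; if_then_else_)
open import Data.Empty using (⊥; ⊥-elim)
open import Data.Fin using (Fin; toℕ; fromℕ<) renaming (zero to fzero; suc to fsuc)
open import Data.Fin.Properties as Finₚ using (toℕ-injective; toℕ-fromℕ<; toℕ<n; any?)
open import Data.List using (List; []; _∷_; _++_; map; concatMap; allFin; applyUpTo; upTo; tabulate; filter; length; null)
open import Data.List.Membership.Propositional using (_∈_; _∉_)
open import Data.List.Properties using (≡-dec)
open import Data.List.Relation.Unary.All as All using (All)
open import Data.List.Relation.Unary.AllPairs using (AllPairs; []; _∷_)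
open import Data.List.Relation.Unary.Any using (here; there)
open import Data.Nat using (ℕ; zero; suc; _+_; _*_; _^_; _∸_; _≤_; _<_; _>_; z≤n; s≤s; _≡ᵇ_)
open import Data.Nat.ListAction using (sum)
open import Data.Nat.Properties hiding (≤ᵇ⇒≤; ≤⇒≤ᵇ)
open import Data.Nat.Tactic.RingSolver using (solve-∀)
open import Data.Product as Product using (Σ; _×_; _,_; proj₁; proj₂; ∃-syntax)
open import Data.Sum using (inj₁; inj₂)
open import Data.Vec as Vec using (Vec; []; _∷_; lookup)
open import Data.Vec.Properties as Vecₚ using (lookup∘tabulate)
open import Function.Base using (_∘_; id)
open import Relation.Binary.Definitions using (tri<; tri≈; tri>)
open import Relation.Binary.PropositionalEquality
open import Relation.Nullary using (Dec; yes; no; does; ¬_; contradiction)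
open import Relation.Nullary.Decidable using (dec-true; dec-false; does-≡; map′; T?; _×-dec_)
open import Relation.Unary using (Pred; Decidable)

open ≡-Reasoning
open import Algebra.Properties.CommutativeSemigroup +-commutativeSemigroup
  using () renaming (interchange to +-interchange)
open import Algebra.Properties.CommutativeSemigroup *-commutativeSemigroup
  using () renaming (x∙yz≈y∙xz to *-left-comm)

𝟙 : Bool → ℕ
𝟙 true  = 1
𝟙 false = 0

∑ : {A : Set} → List A → (A → ℕ) → ℕ
∑ []       f = 0
∑ (x ∷ xs) f = f x + ∑ xs f

syntax ∑ xs (λ x → e) = ∑[ x ∈ xs ] e

∑< : ℕ → (ℕ → ℕ) → ℕ
∑< zero    f = 0
∑< (suc n) f = f 0 + ∑< n (λ i → f (suc i))

syntax ∑< n (λ i → e) = ∑[ i < n ] e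

private variable A B : Set


sum-map≡∑ : (f : A → ℕ) (xs : List A) → sum (map f xs) ≡ ∑ xs f
sum-map≡∑ f []       = refl
sum-map≡∑ f (x ∷ xs) = cong (f x +_) (sum-map≡∑ f xs)

length-filter≡∑ : ∀ {ℓ} {P : Pred A ℓ} (P? : Decidable P) (xs : List A) →
                  length (filter P? xs) ≡ ∑[ x ∈ xs ] 𝟙 (does (P? x))
length-filter≡∑ P? []       = refl
length-filter≡∑ P? (x ∷ xs) with does (P? x)
... | true  = cong suc (length-filter≡∑ P? xs)
... | false = length-filter≡∑ P? xs

∑-cong : {f g : A → ℕ} (xs : List A) → (∀ x → f x ≡ g x) → ∑ xs f ≡ ∑ xs g
∑-cong []       f≗g = refl
∑-cong (x ∷ xs) f≗g = cong₂ _+_ (f≗g x) (∑-cong xs f≗g)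

∑-zero : (xs : List A) {f : A → ℕ} → (∀ x → f x ≡ 0) → ∑ xs f ≡ 0
∑-zero []       f≗0 = refl
∑-zero (x ∷ xs) f≗0 = cong₂ _+_ (f≗0 x) (∑-zero xs f≗0)

∑-++ : (xs ys : List A) (f : A → ℕ) → ∑ (xs ++ ys) f ≡ ∑ xs f + ∑ ys f
∑-++ []       ys f = refl
∑-++ (x ∷ xs) ys f = trans (cong (f x +_) (∑-++ xs ys f)) (sym (+-assoc (f x) _ _))

∑-map : (g : A → B) (xs : List A) (f : B → ℕ) → ∑ (map g xs) f ≡ ∑[ x ∈ xs ] f (g x)
∑-map g []       f = refl
∑-map g (x ∷ xs) f = cong (f (g x) +_) (∑-map g xs f)

∑-concatMap : (g : A → List B) (xs : List A) (f : B → ℕ) →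
              ∑ (concatMap g xs) f ≡ ∑[ x ∈ xs ] ∑ (g x) f
∑-concatMap g []       f = refl
∑-concatMap g (x ∷ xs) f = trans (∑-++ (g x) _ f) (cong (∑ (g x) f +_) (∑-concatMap g xs f))

∑-distrib-+ : (xs : List A) (f g : A → ℕ) → ∑[ x ∈ xs ] (f x + g x) ≡ ∑ xs f + ∑ xs g
∑-distrib-+ []       f g = refl
∑-distrib-+ (x ∷ xs) f g = trans (cong (f x + g x +_) (∑-distrib-+ xs f g)) (+-interchange (f x) (g x) _ _)

∑-distribˡ : (xs : List A) (c : ℕ) (f : A → ℕ) → ∑[ x ∈ xs ] (c * f x) ≡ c * ∑ xs f
∑-distribˡ []       c f = sym (*-zeroʳ c)
∑-distribˡ (x ∷ xs) c f = trans (cong (c * f x +_) (∑-distribˡ xs c f)) (sym (*-distribˡ-+ c (f x) _))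

∑-distribʳ : (xs : List A) (f : A → ℕ) (c : ℕ) → ∑[ x ∈ xs ] (f x * c) ≡ ∑ xs f * c
∑-distribʳ xs f c = trans (∑-cong xs (λ x → *-comm (f x) c)) (trans (∑-distribˡ xs c f) (*-comm c _))

∑-comm : (xs : List A) (ys : List B) (f : A → B → ℕ) →
         ∑[ x ∈ xs ] ∑[ y ∈ ys ] f x y ≡ ∑[ y ∈ ys ] ∑[ x ∈ xs ] f x y
∑-comm []       ys f = sym (∑-zero ys (λ _ → refl))
∑-comm (x ∷ xs) ys f = trans (cong (∑ ys (f x) +_) (∑-comm xs ys f)) (sym (∑-distrib-+ ys (f x) _))

∑-tabulate : ∀ k (g : Fin k → B) (f : B → ℕ) → ∑ (tabulate g) f ≡ ∑[ i ∈ allFin k ] f (g i)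
∑-tabulate zero    g f = refl
∑-tabulate (suc k) g f =
  cong (f (g fzero) +_) (trans (∑-tabulate k (λ i → g (fsuc i)) f) (sym (∑-tabulate k fsuc (λ i → f (g i)))))

∑-allFin-suc : ∀ k (f : Fin (suc k) → ℕ) → ∑ (allFin (suc k)) f ≡ f fzero + ∑[ i ∈ allFin k ] f (fsuc i)
∑-allFin-suc k f = cong (f fzero +_) (∑-tabulate k fsuc f)

∑-allFin-point : ∀ k (c : Fin k) (f : Fin k → ℕ) → (∀ i → i ≢ c → f i ≡ 0) → ∑ (allFin k) f ≡ f c
∑-allFin-point (suc k) fzero f f≗0 = begin
  ∑ (allFin (suc k)) f                     ≡⟨ ∑-allFin-suc k f ⟩
  f fzero + ∑[ i ∈ allFin k ] f (fsuc i)   ≡⟨ cong (f fzero +_) (∑-zero (allFin k) (λ i → f≗0 (fsuc i) (λ ()))) ⟩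
  f fzero + 0                              ≡⟨ +-identityʳ (f fzero) ⟩
  f fzero                                  ∎
∑-allFin-point (suc k) (fsuc c) f f≗0 = begin
  ∑ (allFin (suc k)) f                     ≡⟨ ∑-allFin-suc k f ⟩
  f fzero + ∑[ i ∈ allFin k ] f (fsuc i)   ≡⟨ cong₂ _+_ (f≗0 fzero (λ ()))
                                                (∑-allFin-point k c (λ i → f (fsuc i))
                                                   (λ i i≢c → f≗0 (fsuc i) (i≢c ∘ Finₚ.suc-injective))) ⟩
  f (fsuc c)                               ∎

∑-allFin-toℕ : ∀ n (h : ℕ → ℕ) → ∑[ i ∈ allFin n ] h (toℕ i) ≡ ∑[ j < n ] h j
∑-allFin-toℕ zero    h = refl
∑-allFin-toℕ (suc n) h = trans (∑-allFin-suc n _) (cong (h 0 +_) (∑-allFin-toℕ n (λ i → h (suc i))))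

∑-vecs-suc : ∀ k m (f : Vec (Fin k) (suc m) → ℕ) →
             ∑ (vecs k (suc m)) f ≡ ∑[ x ∈ allFin k ] ∑[ v ∈ vecs k m ] f (x ∷ v)
∑-vecs-suc k m f = trans (∑-concatMap (λ x → map (x ∷_) (vecs k m)) (allFin k) f)
                         (∑-cong (allFin k) (λ x → ∑-map (x ∷_) (vecs k m) f))

∑-vecs-point : ∀ k m (c : Vec (Fin k) m) (f : Vec (Fin k) m → ℕ) → (∀ v → v ≢ c → f v ≡ 0) →
               ∑ (vecs k m) f ≡ f c
∑-vecs-point k zero    []      f f≗0 = +-identityʳ (f [])
∑-vecs-point k (suc m) (x ∷ c) f f≗0 = begin
  ∑ (vecs k (suc m)) f                               ≡⟨ ∑-vecs-suc k m f ⟩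
  ∑[ y ∈ allFin k ] ∑[ v ∈ vecs k m ] f (y ∷ v)      ≡⟨ ∑-allFin-point k x _ (λ y y≢x →
                                                          ∑-zero (vecs k m) (λ v → f≗0 (y ∷ v) (λ e → y≢x (cong Vec.head e)))) ⟩
  ∑[ v ∈ vecs k m ] f (x ∷ v)                        ≡⟨ ∑-vecs-point k m c _ (λ v v≢c →
                                                          f≗0 (x ∷ v) (λ e → v≢c (cong Vec.tail e))) ⟩
  f (x ∷ c)                                          ∎

∑<-cong : ∀ n {f g : ℕ → ℕ} → (∀ i → i < n → f i ≡ g i) → ∑< n f ≡ ∑< n g
∑<-cong zero    f≗g = refl
∑<-cong (suc n) f≗g = cong₂ _+_ (f≗g 0 (s≤s z≤n)) (∑<-cong n (λ i i<n → f≗g (suc i) (s≤s i<n)))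

∑<-zero : ∀ n {f : ℕ → ℕ} → (∀ i → i < n → f i ≡ 0) → ∑< n f ≡ 0
∑<-zero zero    f≗0 = refl
∑<-zero (suc n) f≗0 = cong₂ _+_ (f≗0 0 (s≤s z≤n)) (∑<-zero n (λ i i<n → f≗0 (suc i) (s≤s i<n)))

∑<-distrib-+ : ∀ n (f g : ℕ → ℕ) → ∑[ i < n ] (f i + g i) ≡ ∑< n f + ∑< n g
∑<-distrib-+ zero    f g = refl
∑<-distrib-+ (suc n) f g = trans (cong (f 0 + g 0 +_) (∑<-distrib-+ n _ _)) (+-interchange (f 0) (g 0) _ _)

∑<-distribˡ : ∀ n (c : ℕ) (f : ℕ → ℕ) → ∑[ i < n ] (c * f i) ≡ c * ∑< n f
∑<-distribˡ zero    c f = sym (*-zeroʳ c)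
∑<-distribˡ (suc n) c f = trans (cong (c * f 0 +_) (∑<-distribˡ n c _)) (sym (*-distribˡ-+ c (f 0) _))

∑<-last : ∀ n f → ∑< (suc n) f ≡ ∑< n f + f n
∑<-last zero    f = +-comm (f 0) 0
∑<-last (suc n) f = trans (cong (f 0 +_) (∑<-last n (λ i → f (suc i)))) (sym (+-assoc (f 0) _ _))

∑-upTo : ∀ n (f : ℕ → ℕ) → ∑ (upTo n) f ≡ ∑< n f
∑-upTo n f = ∑-applyUpTo n (λ i → i)
  where
  ∑-applyUpTo : ∀ n (g : ℕ → ℕ) → ∑ (applyUpTo g n) f ≡ ∑[ i < n ] f (g i)
  ∑-applyUpTo zero    g = refl
  ∑-applyUpTo (suc n) g = cong (f (g 0) +_) (∑-applyUpTo n (λ i → g (suc i)))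

∑<-comm : ∀ n m (f : ℕ → ℕ → ℕ) → ∑[ i < n ] ∑[ j < m ] f i j ≡ ∑[ j < m ] ∑[ i < n ] f i j
∑<-comm zero    m f = sym (∑<-zero m (λ _ _ → refl))
∑<-comm (suc n) m f = trans (cong (∑< m (f 0) +_) (∑<-comm n m (λ i → f (suc i)))) (sym (∑<-distrib-+ m (f 0) _))

∑<-∑-comm : (n : ℕ) (xs : List A) (f : A → ℕ → ℕ) →
            ∑[ i < n ] ∑[ x ∈ xs ] f x i ≡ ∑[ x ∈ xs ] ∑[ i < n ] f x i
∑<-∑-comm n []       f = ∑<-zero n (λ _ _ → refl)
∑<-∑-comm n (x ∷ xs) f = trans (∑<-distrib-+ n (f x) _) (cong (∑< n (f x) +_) (∑<-∑-comm n xs f))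

∑<-point : ∀ n c (f : ℕ → ℕ) → c < n → (∀ i → i ≢ c → f i ≡ 0) → ∑< n f ≡ f c
∑<-point (suc n) zero    f _         f≗0 =
  trans (cong (f 0 +_) (∑<-zero n (λ i _ → f≗0 (suc i) (λ ())))) (+-identityʳ (f 0))
∑<-point (suc n) (suc c) f (s≤s c<n) f≗0 =
  cong₂ _+_ (f≗0 0 (λ ())) (∑<-point n c (λ i → f (suc i)) c<n (λ i i≢c → f≗0 (suc i) (λ e → i≢c (suc-injective e))))

∑<-extend : ∀ a b (f : ℕ → ℕ) → a ≤ b → (∀ j → a ≤ j → j < b → f j ≡ 0) → ∑< a f ≡ ∑< b f
∑<-extend a zero    f z≤n _   = refl
∑<-extend a (suc b) f a≤1+b f≗0 with m≤n⇒m<n∨m≡n a≤1+b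
... | inj₂ refl      = refl
... | inj₁ (s≤s a≤b) = begin
  ∑< a f            ≡⟨ ∑<-extend a b f a≤b (λ j a≤j j<b → f≗0 j a≤j (m≤n⇒m≤1+n j<b)) ⟩
  ∑< b f            ≡⟨ sym (+-identityʳ _) ⟩
  ∑< b f + 0        ≡⟨ cong (∑< b f +_) (sym (f≗0 b a≤b ≤-refl)) ⟩
  ∑< b f + f b      ≡⟨ sym (∑<-last b f) ⟩
  ∑< (suc b) f      ∎

∑<-antidiagonals : ∀ n (h : ℕ → ℕ → ℕ) →
  ∑[ m < suc n ] ∑[ i < suc m ] h i (m ∸ i) ≡ ∑[ i < suc n ] ∑[ j < suc (n ∸ i) ] h i j
∑<-antidiagonals zero    h = refl
∑<-antidiagonals (suc n) h = begin
    ∑[ m < suc (suc n) ] D m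
  ≡⟨ ∑<-last (suc n) D ⟩
    ∑[ m < suc n ] D m + D (suc n)
  ≡⟨ cong₂ _+_ (∑<-antidiagonals n h) (∑<-last (suc n) (λ i → h i (suc n ∸ i))) ⟩
    ∑[ i < suc n ] R n i + (∑[ i < suc n ] h i (suc n ∸ i) + h (suc n) (n ∸ n))
  ≡⟨ sym (+-assoc (∑[ i < suc n ] R n i) _ _) ⟩
    ∑[ i < suc n ] R n i + ∑[ i < suc n ] h i (suc n ∸ i) + h (suc n) (n ∸ n)
  ≡⟨ cong₂ _+_ (sym (∑<-distrib-+ (suc n) (R n) (λ i → h i (suc n ∸ i)))) (cong (h (suc n)) (n∸n≡0 n)) ⟩
    ∑[ i < suc n ] (R n i + h i (suc n ∸ i)) + h (suc n) 0
  ≡⟨ cong₂ _+_ (∑<-cong (suc n) row) (sym (trans (cong (λ k → ∑< (suc k) (h (suc n))) (n∸n≡0 n)) (+-identityʳ _))) ⟩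
    ∑[ i < suc n ] R (suc n) i + R (suc n) (suc n)
  ≡⟨ sym (∑<-last (suc n) (R (suc n))) ⟩
    ∑[ i < suc (suc n) ] R (suc n) i
  ∎
  where
  D : ℕ → ℕ
  D m = ∑[ i < suc m ] h i (m ∸ i)
  R : ℕ → ℕ → ℕ
  R n i = ∑[ j < suc (n ∸ i) ] h i j
  row : ∀ i → i < suc n → R n i + h i (suc n ∸ i) ≡ R (suc n) i
  row i (s≤s i≤n) = begin
    R n i + h i (suc n ∸ i)             ≡⟨ cong (λ k → R n i + h i k) (+-∸-assoc 1 i≤n) ⟩
    R n i + h i (suc (n ∸ i))           ≡⟨ sym (∑<-last (suc (n ∸ i)) (h i)) ⟩
    ∑< (suc (suc (n ∸ i))) (h i)        ≡⟨ cong (λ k → ∑< (suc k) (h i)) (sym (+-∸-assoc 1 i≤n)) ⟩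
    R (suc n) i                         ∎

𝟙-∧ : ∀ a b → 𝟙 (a ∧ b) ≡ 𝟙 a * 𝟙 b
𝟙-∧ true  b = sym (+-identityʳ (𝟙 b))
𝟙-∧ false b = refl

does-⇔ : {P : Set} (P? : Dec P) (b : Bool) → (P → T b) → (T b → P) → does P? ≡ b
does-⇔ P? b to from = does-≡ P? (map′ from to (T? b))

-- Unlike Data.Nat's _≤ᵇ_, this one recurses on both arguments: suc m ≤ᵇ suc n reduces to m ≤ᵇ n.
_≤ᵇ_ : ℕ → ℕ → Bool
zero  ≤ᵇ n     = true
suc m ≤ᵇ zero  = false
suc m ≤ᵇ suc n = m ≤ᵇ n

≤⇒≤ᵇ : ∀ {m n} → m ≤ n → (m ≤ᵇ n) ≡ true
≤⇒≤ᵇ z≤n       = refl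
≤⇒≤ᵇ (s≤s m≤n) = ≤⇒≤ᵇ m≤n

>⇒≤ᵇ : ∀ {m n} → n < m → (m ≤ᵇ n) ≡ false
>⇒≤ᵇ {suc m} {zero}  _         = refl
>⇒≤ᵇ {suc m} {suc n} (s≤s n<m) = >⇒≤ᵇ n<m

≤ᵇ⇒≤ : ∀ m n → (m ≤ᵇ n) ≡ true → m ≤ n
≤ᵇ⇒≤ zero    n       _ = z≤n
≤ᵇ⇒≤ (suc m) (suc n) e = s≤s (≤ᵇ⇒≤ m n e)

𝟙-≤ᵇ-guard : ∀ m n {a b} → (m ≤ n → a ≡ b) → 𝟙 (m ≤ᵇ n) * a ≡ 𝟙 (m ≤ᵇ n) * b
𝟙-≤ᵇ-guard m n a≡b with m ≤ᵇ n in eq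
... | true  = cong (1 *_) (a≡b (≤ᵇ⇒≤ m n eq))
... | false = refl

∑<-≤ᵇ-split : ∀ n α (g : ℕ → ℕ) → α < n →
              ∑[ x < n ] (𝟙 (α ≤ᵇ x) * g x) ≡ g α + ∑[ x < n ] (𝟙 (suc α ≤ᵇ x) * g x)
∑<-≤ᵇ-split (suc n) zero    g _         = cong (_+ ∑[ i < n ] (1 * g (suc i))) (+-identityʳ (g 0))
∑<-≤ᵇ-split (suc n) (suc α) g (s≤s α<n) = ∑<-≤ᵇ-split n α (λ x → g (suc x)) α<n

∑<-≤ᵇ-empty : ∀ n α (g : ℕ → ℕ) → n ≤ α → ∑[ x < n ] (𝟙 (α ≤ᵇ x) * g x) ≡ 0
∑<-≤ᵇ-empty zero    α       g _         = refl
∑<-≤ᵇ-empty (suc n) (suc α) g (s≤s n≤α) = ∑<-≤ᵇ-empty n α (λ x → g (suc x)) n≤α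

∑<-≤ᵇ-zero : ∀ n α (g : ℕ → ℕ) → (∀ x → α ≤ x → x < n → g x ≡ 0) → ∑[ x < n ] (𝟙 (α ≤ᵇ x) * g x) ≡ 0
∑<-≤ᵇ-zero n α g g≗0 =
  ∑<-zero n (λ x x<n → trans (𝟙-≤ᵇ-guard α x (λ α≤x → g≗0 x α≤x x<n)) (*-zeroʳ (𝟙 (α ≤ᵇ x))))

𝟙-does-guard : {P : Set} (P? : Dec P) {a b : ℕ} → (P → a ≡ b) → 𝟙 (does P?) * a ≡ 𝟙 (does P?) * b
𝟙-does-guard (yes p) a≡b = cong (1 *_) (a≡b p)
𝟙-does-guard (no _)  _   = refl

length-filter-×≡∑ : ∀ {ℓ} {P Q : Pred A ℓ} (P? : Decidable P) (Q? : Decidable Q) (xs : List A) (c : ℕ) →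
  length (filter (λ x → P? x ×-dec Q? x) xs) * c ≡ ∑[ x ∈ xs ] (𝟙 (does (P? x)) * (𝟙 (does (Q? x)) * c))
length-filter-×≡∑ P? Q? xs c = begin
    length (filter (λ x → P? x ×-dec Q? x) xs) * c
  ≡⟨ cong (_* c) (length-filter≡∑ (λ x → P? x ×-dec Q? x) xs) ⟩
    (∑[ x ∈ xs ] 𝟙 (does (P? x) ∧ does (Q? x))) * c
  ≡⟨ sym (∑-distribʳ xs _ c) ⟩
    ∑[ x ∈ xs ] (𝟙 (does (P? x) ∧ does (Q? x)) * c)
  ≡⟨ ∑-cong xs (λ x → trans (cong (_* c) (𝟙-∧ (does (P? x)) _)) (*-assoc (𝟙 (does (P? x))) _ c)) ⟩
    ∑[ x ∈ xs ] (𝟙 (does (P? x)) * (𝟙 (does (Q? x)) * c))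
  ∎

∑<-indicator : ∀ N e (f : ℕ → ℕ) → e < N → ∑[ k < N ] (𝟙 (e ≡ᵇ k) * f k) ≡ f e
∑<-indicator N e f e<N = begin
  ∑[ k < N ] (𝟙 (e ≡ᵇ k) * f k)   ≡⟨ ∑<-point N e _ e<N (λ k k≢e →
                                        cong (λ b → 𝟙 b * f k) (dec-false (e ≟ k) (k≢e ∘ sym))) ⟩
  𝟙 (e ≡ᵇ e) * f e                 ≡⟨ cong (λ b → 𝟙 b * f e) (dec-true (e ≟ e) refl) ⟩
  1 * f e                          ≡⟨ *-identityˡ (f e) ⟩
  f e                              ∎

∑<-indicator-suc : ∀ n e (f : ℕ → ℕ) → 1 ≤ e → e ≤ n → ∑[ i < n ] (𝟙 (e ≡ᵇ suc i) * f (suc i)) ≡ f e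
∑<-indicator-suc n (suc e) f _ e<n = ∑<-indicator n e (f ∘ suc) e<n

-- Indexing matrices as a column recursion

-- Lower bound for the next bottom entry: zeros may repeat, positive entries may not.
nextBottom : ℕ → ℕ
nextBottom zero    = zero
nextBottom (suc y) = suc (suc y)

y≤nextBottom : ∀ y → y ≤ nextBottom y
y≤nextBottom zero    = z≤n
y≤nextBottom (suc y) = n≤1+n (suc y)

nextBottom-≤ : ∀ y → nextBottom y ≤ y → y ≡ 0
nextBottom-≤ zero    _           = refl
nextBottom-≤ (suc y) (s≤s 2+y≤y) = ⊥-elim (<-irrefl refl 2+y≤y)

module _ {n : ℕ} where

  admissible : ∀ {m} → ℕ → ℕ → Vec (Fin n) m → Vec (Fin n) m → Bool
  admissible α β []       []       = true
  admissible α β (x ∷ r₁) (y ∷ r₂) =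
    α ≤ᵇ toℕ x ∧ β ≤ᵇ toℕ y ∧ toℕ y ≤ᵇ toℕ x ∧ admissible (suc (toℕ x)) (nextBottom (toℕ y)) r₁ r₂

  StrictlyIncreasing : ∀ {m} → Vec (Fin n) m → Set
  StrictlyIncreasing {m} r = ∀ (j k : Fin m) → toℕ j < toℕ k → toℕ (lookup r j) < toℕ (lookup r k)

  WeaklyIncreasing : ∀ {m} → Vec (Fin n) m → Set
  WeaklyIncreasing {m} r = ∀ (j k : Fin m) → toℕ j < toℕ k → toℕ (lookup r j) ≤ toℕ (lookup r k)

  OnlyZeroRepeats : ∀ {m} → Vec (Fin n) m → Set
  OnlyZeroRepeats {m} r = ∀ (j k : Fin m) → toℕ j < toℕ k → lookup r j ≡ lookup r k →
                          (toℕ (lookup r j) ≡ 0) × (toℕ (lookup r k) ≡ 0)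

  Dominates : ∀ {m} → Vec (Fin n) m → Vec (Fin n) m → Set
  Dominates {m} r₁ r₂ = ∀ (j : Fin m) → toℕ (lookup r₂ j) ≤ toℕ (lookup r₁ j)

  BoundedBelow : ∀ {m} → ℕ → Vec (Fin n) m → Set
  BoundedBelow {m} α r = ∀ (j : Fin m) → α ≤ toℕ (lookup r j)

  -- Definitionally the part of IsIndexing (cols m r₁ r₂) after the two size bounds.
  RowConditions : ∀ {m} → Vec (Fin n) m → Vec (Fin n) m → Set
  RowConditions r₁ r₂ = StrictlyIncreasing r₁ × WeaklyIncreasing r₂ × OnlyZeroRepeats r₂ × Dominates r₁ r₂

  Admissible : ∀ {m} → ℕ → ℕ → Vec (Fin n) m → Vec (Fin n) m → Set
  Admissible α β r₁ r₂ = RowConditions r₁ r₂ × BoundedBelow α r₁ × BoundedBelow β r₂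

  T-admissible-∷ : ∀ {m} α β x y (r₁ r₂ : Vec (Fin n) m) → T (admissible α β (x ∷ r₁) (y ∷ r₂)) →
                   α ≤ toℕ x × β ≤ toℕ y × toℕ y ≤ toℕ x × T (admissible (suc (toℕ x)) (nextBottom (toℕ y)) r₁ r₂)
  T-admissible-∷ α β x y r₁ r₂ t with α ≤ᵇ toℕ x in e₁ | β ≤ᵇ toℕ y in e₂ | toℕ y ≤ᵇ toℕ x in e₃
  ... | true  | true  | true  = ≤ᵇ⇒≤ _ _ e₁ , ≤ᵇ⇒≤ _ _ e₂ , ≤ᵇ⇒≤ _ _ e₃ , t
  ... | false | _     | _     = ⊥-elim t
  ... | true  | false | _     = ⊥-elim t
  ... | true  | true  | false = ⊥-elim t

  admissible-∷ : ∀ {m} α β x y (r₁ r₂ : Vec (Fin n) m) → α ≤ toℕ x → β ≤ toℕ y → toℕ y ≤ toℕ x →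
                 T (admissible (suc (toℕ x)) (nextBottom (toℕ y)) r₁ r₂) → T (admissible α β (x ∷ r₁) (y ∷ r₂))
  admissible-∷ α β x y r₁ r₂ α≤x β≤y y≤x t rewrite ≤⇒≤ᵇ α≤x | ≤⇒≤ᵇ β≤y | ≤⇒≤ᵇ y≤x = t

  admissible⇒Admissible : ∀ {m} α β (r₁ r₂ : Vec (Fin n) m) → T (admissible α β r₁ r₂) → Admissible α β r₁ r₂
  admissible⇒Admissible α β []       []       _ = ((λ ()) , (λ ()) , (λ ()) , (λ ())) , (λ ()) , (λ ())
  admissible⇒Admissible α β (x ∷ r₁) (y ∷ r₂) t = (inc₁′ , inc₂′ , rep′ , dom′) , bd₁′ , bd₂′
    where
    head = T-admissible-∷ α β x y r₁ r₂ t
    α≤x = proj₁ head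
    β≤y = proj₁ (proj₂ head)
    y≤x = proj₁ (proj₂ (proj₂ head))
    IH = admissible⇒Admissible _ _ r₁ r₂ (proj₂ (proj₂ (proj₂ head)))
    bd₁ = proj₁ (proj₂ IH)
    bd₂ = proj₂ (proj₂ IH)
    inc₁′ : StrictlyIncreasing (x ∷ r₁)
    inc₁′ fzero    (fsuc k) _         = bd₁ k
    inc₁′ (fsuc j) (fsuc k) (s≤s j<k) = proj₁ (proj₁ IH) j k j<k
    inc₂′ : WeaklyIncreasing (y ∷ r₂)
    inc₂′ fzero    (fsuc k) _         = ≤-trans (y≤nextBottom (toℕ y)) (bd₂ k)
    inc₂′ (fsuc j) (fsuc k) (s≤s j<k) = proj₁ (proj₂ (proj₁ IH)) j k j<k
    rep′ : OnlyZeroRepeats (y ∷ r₂)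
    rep′ fzero    (fsuc k) _ y≡r₂k = y≡0 , trans (sym (cong toℕ y≡r₂k)) y≡0
      where y≡0 = nextBottom-≤ (toℕ y) (subst (nextBottom (toℕ y) ≤_) (sym (cong toℕ y≡r₂k)) (bd₂ k))
    rep′ (fsuc j) (fsuc k) (s≤s j<k) = proj₁ (proj₂ (proj₂ (proj₁ IH))) j k j<k
    dom′ : Dominates (x ∷ r₁) (y ∷ r₂)
    dom′ fzero    = y≤x
    dom′ (fsuc j) = proj₂ (proj₂ (proj₂ (proj₁ IH))) j
    bd₁′ : BoundedBelow α (x ∷ r₁)
    bd₁′ fzero    = α≤x
    bd₁′ (fsuc j) = ≤-trans α≤x (≤-trans (n≤1+n _) (bd₁ j))
    bd₂′ : BoundedBelow β (y ∷ r₂)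
    bd₂′ fzero    = β≤y
    bd₂′ (fsuc j) = ≤-trans β≤y (≤-trans (y≤nextBottom _) (bd₂ j))

  Admissible⇒admissible : ∀ {m} α β (r₁ r₂ : Vec (Fin n) m) → Admissible α β r₁ r₂ → T (admissible α β r₁ r₂)
  Admissible⇒admissible α β []       []       _ = _
  Admissible⇒admissible α β (x ∷ r₁) (y ∷ r₂) ((inc₁ , inc₂ , rep , dom) , bd₁ , bd₂) =
    admissible-∷ α β x y r₁ r₂ (bd₁ fzero) (bd₂ fzero) (dom fzero)
      (Admissible⇒admissible _ _ r₁ r₂ (tail-conditions , (λ j → inc₁ fzero (fsuc j) (s≤s z≤n)) , bd-next))
    where
    tail-conditions : RowConditions r₁ r₂
    tail-conditions = (λ j k j<k → inc₁ (fsuc j) (fsuc k) (s≤s j<k)) , (λ j k j<k → inc₂ (fsuc j) (fsuc k) (s≤s j<k))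
                    , (λ j k j<k → rep (fsuc j) (fsuc k) (s≤s j<k)) , (λ j → dom (fsuc j))
    bd-next : BoundedBelow (nextBottom (toℕ y)) r₂
    bd-next j with toℕ y in ey | m≤n⇒m<n∨m≡n (inc₂ fzero (fsuc j) (s≤s z≤n))
    ... | zero  | _        = z≤n
    ... | suc _ | inj₁ y<r = y<r
    ... | suc _ | inj₂ y≡r = contradiction (proj₁ (rep fzero (fsuc j) (s≤s z≤n) (toℕ-injective (trans ey y≡r))))
                                           (λ y≡0 → 1+n≢0 (trans (sym ey) y≡0))

  zeroColumns : ∀ {m} → Vec (Fin n) m → Vec (Fin n) m → ℕ
  zeroColumns []       []       = 0
  zeroColumns (x ∷ r₁) (y ∷ r₂) = 𝟙 ((toℕ x ≡ᵇ 0) ∨ (toℕ y ≡ᵇ 0)) + zeroColumns r₁ r₂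

  blobRank≡zeroColumns : ∀ {m} (r₁ r₂ : Vec (Fin n) m) → blobRank (cols m r₁ r₂) ≡ zeroColumns r₁ r₂
  blobRank≡zeroColumns {m} r₁ r₂ = trans (length-filter≡∑ _ (allFin m)) (∑-zeroColumns r₁ r₂)
    where
    ∑-zeroColumns : ∀ {m} (r₁ r₂ : Vec (Fin n) m) →
                    ∑[ j ∈ allFin m ] 𝟙 ((toℕ (lookup r₁ j) ≡ᵇ 0) ∨ (toℕ (lookup r₂ j) ≡ᵇ 0)) ≡ zeroColumns r₁ r₂
    ∑-zeroColumns []       []       = refl
    ∑-zeroColumns {suc m} (x ∷ r₁) (y ∷ r₂) =
      trans (∑-allFin-suc m (λ j → 𝟙 ((toℕ (lookup (x ∷ r₁) j) ≡ᵇ 0) ∨ (toℕ (lookup (y ∷ r₂) j) ≡ᵇ 0))))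
            (cong (𝟙 ((toℕ x ≡ᵇ 0) ∨ (toℕ y ≡ᵇ 0)) +_) (∑-zeroColumns r₁ r₂))

  zeroColumns≤m : ∀ {m} (r₁ r₂ : Vec (Fin n) m) → zeroColumns r₁ r₂ ≤ m
  zeroColumns≤m []       []       = z≤n
  zeroColumns≤m (x ∷ r₁) (y ∷ r₂) = +-mono-≤ (𝟙≤1 _) (zeroColumns≤m r₁ r₂)
    where
    𝟙≤1 : ∀ b → 𝟙 b ≤ 1
    𝟙≤1 true  = ≤-refl
    𝟙≤1 false = z≤n

  does-isIndexing? : ∀ {m} (r₁ r₂ : Vec (Fin n) m) →
                     does (isIndexing? (cols m r₁ r₂)) ≡ (1 ≤ᵇ m ∧ m ≤ᵇ n ∧ admissible 0 0 r₁ r₂)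
  does-isIndexing? {m} r₁ r₂ = does-⇔ (isIndexing? (cols m r₁ r₂)) _ to from
    where
    to : IsIndexing (cols m r₁ r₂) → T (1 ≤ᵇ m ∧ m ≤ᵇ n ∧ admissible 0 0 r₁ r₂)
    to (1≤m , m≤n , conditions) rewrite ≤⇒≤ᵇ 1≤m | ≤⇒≤ᵇ m≤n =
      Admissible⇒admissible 0 0 r₁ r₂ (conditions , (λ _ → z≤n) , (λ _ → z≤n))
    from : T (1 ≤ᵇ m ∧ m ≤ᵇ n ∧ admissible 0 0 r₁ r₂) → IsIndexing (cols m r₁ r₂)
    from t with 1 ≤ᵇ m in e₁ | m ≤ᵇ n in e₂
    ... | true  | true  = ≤ᵇ⇒≤ 1 m e₁ , ≤ᵇ⇒≤ m n e₂ , proj₁ (admissible⇒Admissible 0 0 r₁ r₂ t)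
    ... | false | _     = ⊥-elim t
    ... | true  | false = ⊥-elim t

  blobRank≤n : ∀ A → IsIndexing A → blobRank A ≤ n
  blobRank≤n degenerate     _             = z≤n
  blobRank≤n (cols m r₁ r₂) (_ , m≤n , _) =
    subst (_≤ n) (sym (blobRank≡zeroColumns r₁ r₂)) (≤-trans (zeroColumns≤m r₁ r₂) m≤n)

∑-allMats : ∀ n (f : Mat n → ℕ) →
  ∑ (allMats n) f ≡ f degenerate + ∑[ m < suc n ] ∑[ r₁ ∈ vecs n m ] ∑[ r₂ ∈ vecs n m ] f (cols m r₁ r₂)
∑-allMats n f = cong (f degenerate +_) (begin
    ∑ (concatMap (λ m → concatMap (λ r₁ → map (cols m r₁) (vecs n m)) (vecs n m)) (upTo (suc n))) f
  ≡⟨ ∑-concatMap (λ m → concatMap (λ r₁ → map (cols m r₁) (vecs n m)) (vecs n m)) (upTo (suc n)) f ⟩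
    ∑[ m ∈ upTo (suc n) ] ∑ (concatMap (λ r₁ → map (cols m r₁) (vecs n m)) (vecs n m)) f
  ≡⟨ ∑-upTo (suc n) (λ m → ∑ (concatMap (λ r₁ → map (cols m r₁) (vecs n m)) (vecs n m)) f) ⟩
    ∑[ m < suc n ] ∑ (concatMap (λ r₁ → map (cols m r₁) (vecs n m)) (vecs n m)) f
  ≡⟨ ∑<-cong (suc n) (λ m _ → trans (∑-concatMap (λ r₁ → map (cols m r₁) (vecs n m)) (vecs n m) f)
                                    (∑-cong (vecs n m) (λ r₁ → ∑-map (cols m r₁) (vecs n m) f))) ⟩
    ∑[ m < suc n ] ∑[ r₁ ∈ vecs n m ] ∑[ r₂ ∈ vecs n m ] f (cols m r₁ r₂)
  ∎)

module _ (n d : ℕ) where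

  weightedRows : ℕ → ℕ → ℕ → ℕ
  weightedRows zero    α β = 1
  weightedRows (suc m) α β =
    ∑[ x < n ] (𝟙 (α ≤ᵇ x) * ∑[ y < n ] (𝟙 (β ≤ᵇ y) * (𝟙 (y ≤ᵇ x) *
      (d ^ 𝟙 (y ≡ᵇ 0) * weightedRows m (suc x) (nextBottom y)))))

  admissibleWeight : ∀ {m} → ℕ → ℕ → Vec (Fin n) m → Vec (Fin n) m → ℕ
  admissibleWeight α β r₁ r₂ = 𝟙 (admissible α β r₁ r₂) * d ^ zeroColumns r₁ r₂

  columnWeight : ℕ → ℕ → ℕ → ℕ → ℕ
  columnWeight α β x y = 𝟙 (α ≤ᵇ x) * (𝟙 (β ≤ᵇ y) * (𝟙 (y ≤ᵇ x) * d ^ 𝟙 ((x ≡ᵇ 0) ∨ (y ≡ᵇ 0))))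

  admissibleWeight-∷ : ∀ {m} α β x y (r₁ r₂ : Vec (Fin n) m) →
    admissibleWeight α β (x ∷ r₁) (y ∷ r₂)
      ≡ columnWeight α β (toℕ x) (toℕ y) * admissibleWeight (suc (toℕ x)) (nextBottom (toℕ y)) r₁ r₂
  admissibleWeight-∷ α β x y r₁ r₂ = begin
      𝟙 (a ∧ b ∧ c ∧ g) * d ^ (𝟙 z + zeroColumns r₁ r₂)
    ≡⟨ cong₂ _*_ (trans (𝟙-∧ a _) (cong (𝟙 a *_) (trans (𝟙-∧ b _) (cong (𝟙 b *_) (𝟙-∧ c g)))))
                 (^-distribˡ-+-* d (𝟙 z) (zeroColumns r₁ r₂)) ⟩
      (𝟙 a * (𝟙 b * (𝟙 c * 𝟙 g))) * (d ^ 𝟙 z * d ^ zeroColumns r₁ r₂)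
    ≡⟨ rearrange (𝟙 a) (𝟙 b) (𝟙 c) (d ^ 𝟙 z) (𝟙 g) (d ^ zeroColumns r₁ r₂) ⟩
      (𝟙 a * (𝟙 b * (𝟙 c * d ^ 𝟙 z))) * (𝟙 g * d ^ zeroColumns r₁ r₂)
    ∎
    where
    a = α ≤ᵇ toℕ x
    b = β ≤ᵇ toℕ y
    c = toℕ y ≤ᵇ toℕ x
    g = admissible (suc (toℕ x)) (nextBottom (toℕ y)) r₁ r₂
    z = (toℕ x ≡ᵇ 0) ∨ (toℕ y ≡ᵇ 0)
    rearrange : ∀ a b c e g w → (a * (b * (c * g))) * (e * w) ≡ (a * (b * (c * e))) * (g * w)
    rearrange = solve-∀

  -- A zero top entry forces a zero bottom entry below it.
  zeroColumn-weight : ∀ x y F →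
    𝟙 (y ≤ᵇ x) * (d ^ 𝟙 ((x ≡ᵇ 0) ∨ (y ≡ᵇ 0)) * F) ≡ 𝟙 (y ≤ᵇ x) * (d ^ 𝟙 (y ≡ᵇ 0) * F)
  zeroColumn-weight zero    zero    F = refl
  zeroColumn-weight zero    (suc y) F = refl
  zeroColumn-weight (suc x) y       F = refl

  ∑-admissibleWeight : ∀ m α β → ∑[ r₁ ∈ vecs n m ] ∑[ r₂ ∈ vecs n m ] admissibleWeight α β r₁ r₂ ≡ weightedRows m α β
  ∑-admissibleWeight zero    α β = refl
  ∑-admissibleWeight (suc m) α β = begin
      ∑[ r₁ ∈ vecs n (suc m) ] ∑[ r₂ ∈ vecs n (suc m) ] H r₁ r₂
    ≡⟨ ∑-vecs-suc n m _ ⟩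
      ∑[ x ∈ allFin n ] ∑[ r₁ ∈ vecs n m ] ∑[ r₂ ∈ vecs n (suc m) ] H (x ∷ r₁) r₂
    ≡⟨ ∑-cong (allFin n) (λ x → ∑-cong (vecs n m) (λ r₁ → ∑-vecs-suc n m (H (x ∷ r₁)))) ⟩
      ∑[ x ∈ allFin n ] ∑[ r₁ ∈ vecs n m ] ∑[ y ∈ allFin n ] ∑[ r₂ ∈ vecs n m ] H (x ∷ r₁) (y ∷ r₂)
    ≡⟨ ∑-cong (allFin n) (λ x → ∑-comm (vecs n m) (allFin n) _) ⟩
      ∑[ x ∈ allFin n ] ∑[ y ∈ allFin n ] ∑[ r₁ ∈ vecs n m ] ∑[ r₂ ∈ vecs n m ] H (x ∷ r₁) (y ∷ r₂)
    ≡⟨ ∑-cong (allFin n) (λ x → ∑-cong (allFin n) (λ y → first-column x y)) ⟩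
      ∑[ x ∈ allFin n ] ∑[ y ∈ allFin n ] G (toℕ x) (toℕ y)
    ≡⟨ ∑-cong (allFin n) (λ x → ∑-allFin-toℕ n (G (toℕ x))) ⟩
      ∑[ x ∈ allFin n ] ∑[ y < n ] G (toℕ x) y
    ≡⟨ ∑-allFin-toℕ n (λ x → ∑< n (G x)) ⟩
      ∑[ x < n ] ∑[ y < n ] G x y
    ≡⟨ ∑<-cong n (λ x _ → trans (∑<-cong n (λ y _ → factor x y)) (∑<-distribˡ n (𝟙 (α ≤ᵇ x)) _)) ⟩
      weightedRows (suc m) α β
    ∎
    where
    H : Vec (Fin n) (suc m) → Vec (Fin n) (suc m) → ℕ
    H = admissibleWeight α β
    G : ℕ → ℕ → ℕ
    G x y = columnWeight α β x y * weightedRows m (suc x) (nextBottom y)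
    first-column : ∀ x y → ∑[ r₁ ∈ vecs n m ] ∑[ r₂ ∈ vecs n m ] H (x ∷ r₁) (y ∷ r₂) ≡ G (toℕ x) (toℕ y)
    first-column x y = begin
        ∑[ r₁ ∈ vecs n m ] ∑[ r₂ ∈ vecs n m ] H (x ∷ r₁) (y ∷ r₂)
      ≡⟨ ∑-cong (vecs n m) (λ r₁ → trans (∑-cong (vecs n m) (admissibleWeight-∷ α β x y r₁)) (∑-distribˡ (vecs n m) w _)) ⟩
        ∑[ r₁ ∈ vecs n m ] (w * ∑[ r₂ ∈ vecs n m ] admissibleWeight (suc (toℕ x)) (nextBottom (toℕ y)) r₁ r₂)
      ≡⟨ ∑-distribˡ (vecs n m) w _ ⟩
        w * ∑[ r₁ ∈ vecs n m ] ∑[ r₂ ∈ vecs n m ] admissibleWeight (suc (toℕ x)) (nextBottom (toℕ y)) r₁ r₂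
      ≡⟨ cong (w *_) (∑-admissibleWeight m (suc (toℕ x)) (nextBottom (toℕ y))) ⟩
        G (toℕ x) (toℕ y)
      ∎
      where w = columnWeight α β (toℕ x) (toℕ y)
    factor : ∀ x y →
      G x y ≡ 𝟙 (α ≤ᵇ x) * (𝟙 (β ≤ᵇ y) * (𝟙 (y ≤ᵇ x) * (d ^ 𝟙 (y ≡ᵇ 0) * weightedRows m (suc x) (nextBottom y))))
    factor x y = trans (reassoc (𝟙 (α ≤ᵇ x)) (𝟙 (β ≤ᵇ y)) (𝟙 (y ≤ᵇ x)) _ _)
                       (cong (λ t → 𝟙 (α ≤ᵇ x) * (𝟙 (β ≤ᵇ y) * t)) (zeroColumn-weight x y _))
      where
      reassoc : ∀ a b c e f → (a * (b * (c * e))) * f ≡ a * (b * (c * (e * f)))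
      reassoc = solve-∀

  indexingWeight : Mat n → ℕ
  indexingWeight A = 𝟙 (does (isIndexing? A)) * d ^ blobRank A

  indexingWeight-cols : ∀ m (r₁ r₂ : Vec (Fin n) m) → m ≤ n →
                        indexingWeight (cols m r₁ r₂) ≡ 𝟙 (1 ≤ᵇ m) * admissibleWeight 0 0 r₁ r₂
  indexingWeight-cols m r₁ r₂ m≤n = begin
      𝟙 (does (isIndexing? (cols m r₁ r₂))) * d ^ blobRank (cols m r₁ r₂)
    ≡⟨ cong₂ (λ b k → 𝟙 b * d ^ k) (does-isIndexing? r₁ r₂) (blobRank≡zeroColumns r₁ r₂) ⟩
      𝟙 (1 ≤ᵇ m ∧ m ≤ᵇ n ∧ admissible 0 0 r₁ r₂) * d ^ zeroColumns r₁ r₂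
    ≡⟨ cong (λ b → 𝟙 (1 ≤ᵇ m ∧ b ∧ admissible 0 0 r₁ r₂) * d ^ zeroColumns r₁ r₂) (≤⇒≤ᵇ m≤n) ⟩
      𝟙 (1 ≤ᵇ m ∧ admissible 0 0 r₁ r₂) * d ^ zeroColumns r₁ r₂
    ≡⟨ trans (cong (_* d ^ zeroColumns r₁ r₂) (𝟙-∧ (1 ≤ᵇ m) _)) (*-assoc (𝟙 (1 ≤ᵇ m)) _ _) ⟩
      𝟙 (1 ≤ᵇ m) * admissibleWeight 0 0 r₁ r₂
    ∎

  ∑-indexingWeight : ∑ (allMats n) indexingWeight ≡ ∑[ m < suc n ] weightedRows m 0 0
  ∑-indexingWeight = begin
      ∑ (allMats n) indexingWeight
    ≡⟨ ∑-allMats n indexingWeight ⟩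
      1 + ∑[ m < suc n ] ∑[ r₁ ∈ vecs n m ] ∑[ r₂ ∈ vecs n m ] indexingWeight (cols m r₁ r₂)
    ≡⟨ cong (1 +_) (∑<-cong (suc n) (λ m m<1+n → ∑-cong (vecs n m) (λ r₁ →
         trans (∑-cong (vecs n m) (λ r₂ → indexingWeight-cols m r₁ r₂ (≤-pred m<1+n)))
               (∑-distribˡ (vecs n m) (𝟙 (1 ≤ᵇ m)) (admissibleWeight 0 0 r₁))))) ⟩
      1 + ∑[ m < suc n ] ∑[ r₁ ∈ vecs n m ] (𝟙 (1 ≤ᵇ m) * ∑[ r₂ ∈ vecs n m ] admissibleWeight 0 0 r₁ r₂)
    ≡⟨ cong (1 +_) (∑<-cong (suc n) (λ m _ → trans (∑-distribˡ (vecs n m) (𝟙 (1 ≤ᵇ m)) _)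
                                                   (cong (𝟙 (1 ≤ᵇ m) *_) (∑-admissibleWeight m 0 0)))) ⟩
      1 + ∑[ m < suc n ] (𝟙 (1 ≤ᵇ m) * weightedRows m 0 0)
    ≡⟨ cong (1 +_) (∑<-cong n (λ m _ → +-identityʳ _)) ⟩
      ∑[ m < suc n ] weightedRows m 0 0
    ∎

  ∑Ω≡∑weightedRows : sumFromTo 0 n (λ k → Ω k n * d ^ k) ≡ ∑[ m < suc n ] weightedRows m 0 0
  ∑Ω≡∑weightedRows = begin
      sumFromTo 0 n (λ k → Ω k n * d ^ k)
    ≡⟨ trans (sum-map≡∑ (λ k → Ω k n * d ^ k) (upTo (suc n))) (∑-upTo (suc n) (λ k → Ω k n * d ^ k)) ⟩
      ∑[ k < suc n ] (Ω k n * d ^ k)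
    ≡⟨ ∑<-cong (suc n) (λ k _ → length-filter-×≡∑ isIndexing? (λ A → blobRank A ≟ k) (allMats n) (d ^ k)) ⟩
      ∑[ k < suc n ] ∑[ A ∈ allMats n ] (𝟙 (does (isIndexing? A)) * (𝟙 (blobRank A ≡ᵇ k) * d ^ k))
    ≡⟨ ∑<-∑-comm (suc n) (allMats n) (λ A k → 𝟙 (does (isIndexing? A)) * (𝟙 (blobRank A ≡ᵇ k) * d ^ k)) ⟩
      ∑[ A ∈ allMats n ] ∑[ k < suc n ] (𝟙 (does (isIndexing? A)) * (𝟙 (blobRank A ≡ᵇ k) * d ^ k))
    ≡⟨ ∑-cong (allMats n) (λ A → trans (∑<-distribˡ (suc n) (𝟙 (does (isIndexing? A))) (λ k → 𝟙 (blobRank A ≡ᵇ k) * d ^ k))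
                                       (𝟙-does-guard (isIndexing? A) (λ A-indexing →
                                          ∑<-indicator (suc n) (blobRank A) (d ^_) (s≤s (blobRank≤n A A-indexing))))) ⟩
      ∑ (allMats n) indexingWeight
    ≡⟨ ∑-indexingWeight ⟩
      ∑[ m < suc n ] weightedRows m 0 0
    ∎

-- Splitting off the zero columns

module _ (n : ℕ) where

  -- rows p m α β counts the admissible row pairs made of p zero columns followed by m columns with
  -- a positive bottom entry, all top entries being ≥ α and all positive bottom entries ≥ β.
  rows : ℕ → ℕ → ℕ → ℕ → ℕ
  rows zero    zero    α β = 1
  rows zero    (suc m) α β =
    ∑[ x < n ] (𝟙 (α ≤ᵇ x) * ∑[ y < n ] (𝟙 (β ≤ᵇ y) * (𝟙 (y ≤ᵇ x) * rows zero m (suc x) (suc y))))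
  rows (suc p) m       α β = ∑[ x < n ] (𝟙 (α ≤ᵇ x) * rows p m (suc x) β)

module _ (n d : ℕ) where

  weightedRows-positive : ∀ m α β → 1 ≤ β → weightedRows n d m α β ≡ rows n 0 m α β
  weightedRows-positive zero    α β       _ = refl
  weightedRows-positive (suc m) α (suc β) _ =
    ∑<-cong n (λ x _ → cong (𝟙 (α ≤ᵇ x) *_) (∑<-cong n (λ y _ → column x y)))
    where
    column : ∀ x y → 𝟙 (suc β ≤ᵇ y) * (𝟙 (y ≤ᵇ x) * (d ^ 𝟙 (y ≡ᵇ 0) * weightedRows n d m (suc x) (nextBottom y)))
                   ≡ 𝟙 (suc β ≤ᵇ y) * (𝟙 (y ≤ᵇ x) * rows n 0 m (suc x) (suc y))
    column x zero    = refl
    column x (suc y) = cong (λ r → 𝟙 (β ≤ᵇ y) * (𝟙 (suc y ≤ᵇ x) * r))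
                            (trans (+-identityʳ _) (weightedRows-positive m (suc x) (suc (suc y)) (s≤s z≤n)))

  weightedRows-zero : ∀ m α → weightedRows n d m α 0 ≡ ∑[ z < suc m ] (d ^ z * rows n z (m ∸ z) α 1)
  weightedRows-zero zero    α = refl
  weightedRows-zero (suc m) α = begin
      weightedRows n d (suc m) α 0
    ≡⟨ ∑<-cong n (λ x x<n → cong (𝟙 (α ≤ᵇ x) *_) (first-bottom x x<n)) ⟩
      ∑[ x < n ] (𝟙 (α ≤ᵇ x) * (d * weightedRows n d m (suc x) 0 + Y x))
    ≡⟨ trans (∑<-cong n (λ x _ → *-distribˡ-+ (𝟙 (α ≤ᵇ x)) _ (Y x)))
             (∑<-distrib-+ n (λ x → 𝟙 (α ≤ᵇ x) * (d * weightedRows n d m (suc x) 0)) (λ x → 𝟙 (α ≤ᵇ x) * Y x)) ⟩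
      ∑[ x < n ] (𝟙 (α ≤ᵇ x) * (d * weightedRows n d m (suc x) 0)) + rows n 0 (suc m) α 1
    ≡⟨ +-comm _ (rows n 0 (suc m) α 1) ⟩
      rows n 0 (suc m) α 1 + ∑[ x < n ] (𝟙 (α ≤ᵇ x) * (d * weightedRows n d m (suc x) 0))
    ≡⟨ cong (rows n 0 (suc m) α 1 +_) zero-first ⟩
      rows n 0 (suc m) α 1 + d * ∑[ z < suc m ] (d ^ z * rows n (suc z) (m ∸ z) α 1)
    ≡⟨ cong (rows n 0 (suc m) α 1 +_) (sym (trans (∑<-cong (suc m) (λ z _ → *-assoc d (d ^ z) (rows n (suc z) (m ∸ z) α 1)))
                                                  (∑<-distribˡ (suc m) d (λ z → d ^ z * rows n (suc z) (m ∸ z) α 1)))) ⟩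
      rows n 0 (suc m) α 1 + ∑[ z < suc m ] (d ^ suc z * rows n (suc z) (m ∸ z) α 1)
    ≡⟨ cong (_+ ∑[ z < suc m ] (d ^ suc z * rows n (suc z) (m ∸ z) α 1)) (sym (+-identityʳ (rows n 0 (suc m) α 1))) ⟩
      ∑[ z < suc (suc m) ] (d ^ z * rows n z (suc m ∸ z) α 1)
    ∎
    where
    Y : ℕ → ℕ
    Y x = ∑[ y < n ] (𝟙 (1 ≤ᵇ y) * (𝟙 (y ≤ᵇ x) * rows n 0 m (suc x) (suc y)))
    g : ℕ → ℕ → ℕ
    g x y = 𝟙 (y ≤ᵇ x) * (d ^ 𝟙 (y ≡ᵇ 0) * weightedRows n d m (suc x) (nextBottom y))
    first-bottom : ∀ x → x < n → ∑[ y < n ] (𝟙 (0 ≤ᵇ y) * g x y) ≡ d * weightedRows n d m (suc x) 0 + Y x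
    first-bottom x x<n = begin
        ∑[ y < n ] (𝟙 (0 ≤ᵇ y) * g x y)
      ≡⟨ ∑<-≤ᵇ-split n 0 (g x) (≤-<-trans z≤n x<n) ⟩
        g x 0 + ∑[ y < n ] (𝟙 (1 ≤ᵇ y) * g x y)
      ≡⟨ cong₂ _+_ (trans (+-identityʳ _) (cong (_* weightedRows n d m (suc x) 0) (*-identityʳ d)))
                   (∑<-cong n (λ y _ → positive-bottom y)) ⟩
        d * weightedRows n d m (suc x) 0 + Y x
      ∎
      where
      positive-bottom : ∀ y → 𝟙 (1 ≤ᵇ y) * g x y ≡ 𝟙 (1 ≤ᵇ y) * (𝟙 (y ≤ᵇ x) * rows n 0 m (suc x) (suc y))
      positive-bottom zero    = refl
      positive-bottom (suc y) = cong (λ r → 1 * (𝟙 (suc y ≤ᵇ x) * r))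
                                     (trans (+-identityʳ _) (weightedRows-positive m (suc x) (suc (suc y)) (s≤s z≤n)))
    zero-first : ∑[ x < n ] (𝟙 (α ≤ᵇ x) * (d * weightedRows n d m (suc x) 0))
               ≡ d * ∑[ z < suc m ] (d ^ z * rows n (suc z) (m ∸ z) α 1)
    zero-first = begin
        ∑[ x < n ] (𝟙 (α ≤ᵇ x) * (d * weightedRows n d m (suc x) 0))
      ≡⟨ trans (∑<-cong n (λ x _ → *-left-comm (𝟙 (α ≤ᵇ x)) d _))
               (∑<-distribˡ n d (λ x → 𝟙 (α ≤ᵇ x) * weightedRows n d m (suc x) 0)) ⟩
        d * ∑[ x < n ] (𝟙 (α ≤ᵇ x) * weightedRows n d m (suc x) 0)
      ≡⟨ cong (d *_) (∑<-cong n (λ x _ → trans (cong (𝟙 (α ≤ᵇ x) *_) (weightedRows-zero m (suc x)))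
                                              (sym (∑<-distribˡ (suc m) (𝟙 (α ≤ᵇ x))
                                                                (λ z → d ^ z * rows n z (m ∸ z) (suc x) 1))))) ⟩
        d * ∑[ x < n ] ∑[ z < suc m ] (𝟙 (α ≤ᵇ x) * (d ^ z * rows n z (m ∸ z) (suc x) 1))
      ≡⟨ cong (d *_) (∑<-comm n (suc m) (λ x z → 𝟙 (α ≤ᵇ x) * (d ^ z * rows n z (m ∸ z) (suc x) 1))) ⟩
        d * ∑[ z < suc m ] ∑[ x < n ] (𝟙 (α ≤ᵇ x) * (d ^ z * rows n z (m ∸ z) (suc x) 1))
      ≡⟨ cong (d *_) (∑<-cong (suc m) (λ z _ → trans (∑<-cong n (λ x _ → *-left-comm (𝟙 (α ≤ᵇ x)) (d ^ z) _))
                                                      (∑<-distribˡ n (d ^ z) (λ x → 𝟙 (α ≤ᵇ x) * rows n z (m ∸ z) (suc x) 1)))) ⟩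
        d * ∑[ z < suc m ] (d ^ z * rows n (suc z) (m ∸ z) α 1)
      ∎

-- Scanning the values 0, 1, …, n - 1

lower : (ℕ → ℕ) → ℕ → ℕ
lower f zero    = 0
lower f (suc p) = f p

lower-cong : ∀ {f g : ℕ → ℕ} p → (∀ q → f q ≡ g q) → lower f p ≡ lower g p
lower-cong zero    _   = refl
lower-cong (suc p) f≗g = f≗g p

-- Paths from height p down to 0 with steps -1, +1 and two kinds of level steps, never below 0.
motzkin : ℕ → ℕ → ℕ
motzkin zero    p = 𝟙 (p ≡ᵇ 0)
motzkin (suc L) p = lower (motzkin L) p + motzkin L p + (motzkin L (suc p) + motzkin L p)

module _ (n : ℕ) where

  rows-top-split : ∀ p m α β → α < n → rows n (suc p) m α β ≡ rows n p m (suc α) β + rows n (suc p) m (suc α) β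
  rows-top-split p m α β = ∑<-≤ᵇ-split n α (λ x → rows n p m (suc x) β)

  rows-bottom-irrelevant : ∀ p α β γ → rows n p 0 α β ≡ rows n p 0 α γ
  rows-bottom-irrelevant zero    α β γ = refl
  rows-bottom-irrelevant (suc p) α β γ = ∑<-cong n (λ x _ → cong (𝟙 (α ≤ᵇ x) *_) (rows-bottom-irrelevant p (suc x) β γ))

  -- A first positive column with bottom entry β is counted like one more zero column.
  rows-bottom-split : ∀ p m α β → β ≤ α →
                      rows n p (suc m) α β ≡ rows n (suc p) m α (suc β) + rows n p (suc m) α (suc β)
  rows-bottom-split zero m α β β≤α = begin
      ∑[ x < n ] (𝟙 (α ≤ᵇ x) * ∑[ y < n ] (𝟙 (β ≤ᵇ y) * h x y))
    ≡⟨ ∑<-cong n (λ x x<n → trans (𝟙-≤ᵇ-guard α x (λ α≤x →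
                                      first-bottom x (≤-<-trans (≤-trans β≤α α≤x) x<n) (≤-trans β≤α α≤x)))
                                  (*-distribˡ-+ (𝟙 (α ≤ᵇ x)) _ _)) ⟩
      ∑[ x < n ] (𝟙 (α ≤ᵇ x) * rows n 0 m (suc x) (suc β) + 𝟙 (α ≤ᵇ x) * ∑[ y < n ] (𝟙 (suc β ≤ᵇ y) * h x y))
    ≡⟨ ∑<-distrib-+ n (λ x → 𝟙 (α ≤ᵇ x) * rows n 0 m (suc x) (suc β))
                      (λ x → 𝟙 (α ≤ᵇ x) * ∑[ y < n ] (𝟙 (suc β ≤ᵇ y) * h x y)) ⟩
      rows n 1 m α (suc β) + rows n 0 (suc m) α (suc β)
    ∎
    where
    h : ℕ → ℕ → ℕ
    h x y = 𝟙 (y ≤ᵇ x) * rows n zero m (suc x) (suc y)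
    first-bottom : ∀ x → β < n → β ≤ x →
                   ∑[ y < n ] (𝟙 (β ≤ᵇ y) * h x y) ≡ rows n 0 m (suc x) (suc β) + ∑[ y < n ] (𝟙 (suc β ≤ᵇ y) * h x y)
    first-bottom x β<n β≤x = trans (∑<-≤ᵇ-split n β (h x) β<n)
      (cong (_+ ∑[ y < n ] (𝟙 (suc β ≤ᵇ y) * h x y))
            (trans (cong (λ b → 𝟙 b * rows n 0 m (suc x) (suc β)) (≤⇒≤ᵇ β≤x)) (+-identityʳ _)))
  rows-bottom-split (suc p) m α β β≤α = begin
      ∑[ x < n ] (𝟙 (α ≤ᵇ x) * rows n p (suc m) (suc x) β)
    ≡⟨ ∑<-cong n (λ x _ → trans (𝟙-≤ᵇ-guard α x (λ α≤x →
                                    rows-bottom-split p m (suc x) β (≤-trans β≤α (m≤n⇒m≤1+n α≤x))))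
                                (*-distribˡ-+ (𝟙 (α ≤ᵇ x)) _ _)) ⟩
      ∑[ x < n ] (𝟙 (α ≤ᵇ x) * rows n (suc p) m (suc x) (suc β) + 𝟙 (α ≤ᵇ x) * rows n p (suc m) (suc x) (suc β))
    ≡⟨ ∑<-distrib-+ n (λ x → 𝟙 (α ≤ᵇ x) * rows n (suc p) m (suc x) (suc β))
                      (λ x → 𝟙 (α ≤ᵇ x) * rows n p (suc m) (suc x) (suc β)) ⟩
      rows n (suc (suc p)) m α (suc β) + rows n (suc p) (suc m) α (suc β)
    ∎

  rows-top-skip : ∀ m α → α < n → rows n 0 (suc m) α (suc α) ≡ rows n 0 (suc m) (suc α) (suc α)
  rows-top-skip m α α<n = begin
      rows n 0 (suc m) α (suc α)
    ≡⟨ ∑<-≤ᵇ-split n α _ α<n ⟩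
      ∑[ y < n ] (𝟙 (suc α ≤ᵇ y) * (𝟙 (y ≤ᵇ α) * rows n 0 m (suc α) (suc y))) + rows n 0 (suc m) (suc α) (suc α)
    ≡⟨ cong (_+ rows n 0 (suc m) (suc α) (suc α)) (∑<-zero n (λ y _ → no-room α y _)) ⟩
      rows n 0 (suc m) (suc α) (suc α)
    ∎
    where
    no-room : ∀ a y c → 𝟙 (suc a ≤ᵇ y) * (𝟙 (y ≤ᵇ a) * c) ≡ 0
    no-room a       zero    c = refl
    no-room zero    (suc y) c = refl
    no-room (suc a) (suc y) c = no-room a y c

  -- Read rows n p m v v as a scan over the value v: v is unused, is the top entry of one of the p
  -- columns still waiting for one, or is the bottom entry of a positive column whose top entry is
  -- v itself or still to come.
  rows-step : ∀ p m v → v < n →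
    rows n p m v v ≡ lower (λ q → rows n q m (suc v) (suc v)) p + rows n p m (suc v) (suc v)
                     + lower (λ k → rows n (suc p) k (suc v) (suc v) + rows n p k (suc v) (suc v)) m
  rows-step zero    zero    v v<n = refl
  rows-step (suc p) zero    v v<n = begin
      rows n (suc p) 0 v v
    ≡⟨ rows-top-split p 0 v v v<n ⟩
      rows n p 0 (suc v) v + rows n (suc p) 0 (suc v) v
    ≡⟨ cong₂ _+_ (rows-bottom-irrelevant p (suc v) v (suc v)) (rows-bottom-irrelevant (suc p) (suc v) v (suc v)) ⟩
      rows n p 0 (suc v) (suc v) + rows n (suc p) 0 (suc v) (suc v)
    ≡⟨ sym (+-identityʳ _) ⟩
      rows n p 0 (suc v) (suc v) + rows n (suc p) 0 (suc v) (suc v) + 0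
    ∎
  rows-step zero    (suc m) v v<n = begin
      rows n 0 (suc m) v v
    ≡⟨ rows-bottom-split 0 m v v ≤-refl ⟩
      rows n 1 m v (suc v) + rows n 0 (suc m) v (suc v)
    ≡⟨ cong₂ _+_ (rows-top-split 0 m v (suc v) v<n) (rows-top-skip m v v<n) ⟩
      (rows n 0 m v′ v′ + rows n 1 m v′ v′) + rows n 0 (suc m) v′ v′
    ≡⟨ trans (+-comm _ (rows n 0 (suc m) v′ v′)) (cong (rows n 0 (suc m) v′ v′ +_) (+-comm (rows n 0 m v′ v′) _)) ⟩
      rows n 0 (suc m) v′ v′ + (rows n 1 m v′ v′ + rows n 0 m v′ v′)
    ∎
    where v′ = suc v
  rows-step (suc p) (suc m) v v<n = begin
      rows n (suc p) (suc m) v v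
    ≡⟨ rows-bottom-split (suc p) m v v ≤-refl ⟩
      rows n (suc (suc p)) m v v′ + rows n (suc p) (suc m) v v′
    ≡⟨ cong₂ _+_ (rows-top-split (suc p) m v v′ v<n) (rows-top-split p (suc m) v v′ v<n) ⟩
      (rows n (suc p) m v′ v′ + rows n (suc (suc p)) m v′ v′) + (rows n p (suc m) v′ v′ + rows n (suc p) (suc m) v′ v′)
    ≡⟨ rearrange (rows n (suc p) m v′ v′) (rows n (suc (suc p)) m v′ v′)
                 (rows n p (suc m) v′ v′) (rows n (suc p) (suc m) v′ v′) ⟩
      rows n p (suc m) v′ v′ + rows n (suc p) (suc m) v′ v′ + (rows n (suc (suc p)) m v′ v′ + rows n (suc p) m v′ v′)
    ∎
    where
    v′ = suc v
    rearrange : ∀ a b c e → (a + b) + (c + e) ≡ (c + e) + (b + a)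
    rearrange a b c e = trans (+-comm (a + b) (c + e)) (cong ((c + e) +_) (+-comm a b))

  private
    above-bound : ∀ {k α x} → n < suc (k + α) → α ≤ x → n < k + suc x
    above-bound {k} {α} {x} n<1+k+α α≤x = ≤-trans n<1+k+α (≤-reflexive-+-suc (+-monoʳ-≤ k α≤x))
      where
      ≤-reflexive-+-suc : k + α ≤ k + x → suc (k + α) ≤ k + suc x
      ≤-reflexive-+-suc le = subst (suc (k + α) ≤_) (sym (+-suc k x)) (s≤s le)

  mutual
    rows-vanish : ∀ p m α β → n < p + m + α → 0 < p + m → rows n p m α β ≡ 0
    rows-vanish (suc p) m       α β n<  _ =
      ∑<-≤ᵇ-zero n α _ (λ x α≤x x<n → rows-vanish-next p m x β x<n (above-bound n< α≤x))
    rows-vanish zero    (suc m) α β n<  _ =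
      ∑<-≤ᵇ-zero n α _ (λ x α≤x x<n → ∑<-zero n (λ y _ →
        trans (cong (λ r → 𝟙 (β ≤ᵇ y) * (𝟙 (y ≤ᵇ x) * r)) (rows-vanish-next 0 m x (suc y) x<n (above-bound n< α≤x)))
              (trans (cong (𝟙 (β ≤ᵇ y) *_) (*-zeroʳ (𝟙 (y ≤ᵇ x)))) (*-zeroʳ (𝟙 (β ≤ᵇ y))))))

    rows-vanish-next : ∀ p m x β → x < n → n < p + m + suc x → rows n p m (suc x) β ≡ 0
    rows-vanish-next zero    zero    x β x<n n<1+x = contradiction (≤-pred n<1+x) (<⇒≱ x<n)
    rows-vanish-next zero    (suc m) x β _   n<    = rows-vanish 0 (suc m) (suc x) β n< (s≤s z≤n)
    rows-vanish-next (suc p) m       x β _   n<    = rows-vanish (suc p) m (suc x) β n< (s≤s z≤n)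

module _ (n : ℕ) (1≤n : 1 ≤ n) where

  rowsFrom : ℕ → ℕ → ℕ
  rowsFrom v p = ∑[ m < suc n ] rows n p m v v

  private
    ∑<-lower : ∀ v p → ∑[ m < suc n ] lower (λ q → rows n q m v v) p ≡ lower (rowsFrom v) p
    ∑<-lower v zero    = ∑<-zero (suc n) (λ _ _ → refl)
    ∑<-lower v (suc p) = refl

    ∑<n-rows : ∀ q v → ∑[ m < n ] rows n q m (suc v) (suc v) ≡ rowsFrom (suc v) q
    ∑<n-rows q v = sym (begin
        ∑[ m < suc n ] rows n q m (suc v) (suc v)
      ≡⟨ ∑<-last n (λ m → rows n q m (suc v) (suc v)) ⟩
        ∑[ m < n ] rows n q m (suc v) (suc v) + rows n q n (suc v) (suc v)
      ≡⟨ cong (∑[ m < n ] rows n q m (suc v) (suc v) +_) (rows-vanish n q n (suc v) (suc v) n<q+n+1+v (≤-trans 1≤n (m≤n+m n q))) ⟩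
        ∑[ m < n ] rows n q m (suc v) (suc v) + 0
      ≡⟨ +-identityʳ _ ⟩
        ∑[ m < n ] rows n q m (suc v) (suc v)
      ∎)
      where
      n<q+n+1+v : n < q + n + suc v
      n<q+n+1+v = subst (n <_) (sym (+-suc (q + n) v)) (s≤s (≤-trans (m≤n+m n q) (m≤m+n (q + n) v)))

  rowsFrom-step : ∀ v p → v < n →
    rowsFrom v p ≡ lower (rowsFrom (suc v)) p + rowsFrom (suc v) p + (rowsFrom (suc v) (suc p) + rowsFrom (suc v) p)
  rowsFrom-step v p v<n = begin
      ∑[ m < suc n ] rows n p m v v
    ≡⟨ ∑<-cong (suc n) (λ m _ → rows-step n p m v v<n) ⟩
      ∑[ m < suc n ] (lower (λ q → rows n q m v′ v′) p + rows n p m v′ v′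
                      + lower (λ k → rows n (suc p) k v′ v′ + rows n p k v′ v′) m)
    ≡⟨ ∑<-distrib-+ (suc n) (λ m → lower (λ q → rows n q m v′ v′) p + rows n p m v′ v′)
                             (lower (λ k → rows n (suc p) k v′ v′ + rows n p k v′ v′)) ⟩
      ∑[ m < suc n ] (lower (λ q → rows n q m v′ v′) p + rows n p m v′ v′)
        + ∑[ m < suc n ] lower (λ k → rows n (suc p) k v′ v′ + rows n p k v′ v′) m
    ≡⟨ cong₂ _+_ (trans (∑<-distrib-+ (suc n) (λ m → lower (λ q → rows n q m v′ v′) p) (λ m → rows n p m v′ v′))
                        (cong (_+ rowsFrom v′ p) (∑<-lower v′ p)))
                 (trans (∑<-distrib-+ n (λ k → rows n (suc p) k v′ v′) (λ k → rows n p k v′ v′))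
                        (cong₂ _+_ (∑<n-rows (suc p) v) (∑<n-rows p v))) ⟩
      lower (rowsFrom v′) p + rowsFrom v′ p + (rowsFrom v′ (suc p) + rowsFrom v′ p)
    ∎
    where v′ = suc v

  rowsFrom-end : ∀ p → rowsFrom n p ≡ motzkin 0 p
  rowsFrom-end zero    = cong (1 +_) (∑<-zero n (λ m _ → ∑<-≤ᵇ-empty n n _ ≤-refl))
  rowsFrom-end (suc p) = cong₂ _+_ (∑<-≤ᵇ-empty n n _ ≤-refl) (∑<-zero n (λ m _ → ∑<-≤ᵇ-empty n n _ ≤-refl))

  rowsFrom≡motzkin : ∀ L v p → v + L ≡ n → rowsFrom v p ≡ motzkin L p
  rowsFrom≡motzkin zero    v p v+0≡n = subst (λ w → rowsFrom w p ≡ motzkin 0 p) (trans (sym v+0≡n) (+-identityʳ v)) (rowsFrom-end p)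
  rowsFrom≡motzkin (suc L) v p v+1+L≡n = begin
      rowsFrom v p
    ≡⟨ rowsFrom-step v p v<n ⟩
      lower (rowsFrom (suc v)) p + rowsFrom (suc v) p + (rowsFrom (suc v) (suc p) + rowsFrom (suc v) p)
    ≡⟨ cong₂ _+_ (cong₂ _+_ (lower-cong p (λ q → IH q)) (IH p)) (cong₂ _+_ (IH (suc p)) (IH p)) ⟩
      motzkin (suc L) p
    ∎
    where
    1+v+L≡n : suc v + L ≡ n
    1+v+L≡n = trans (sym (+-suc v L)) v+1+L≡n
    IH : ∀ q → rowsFrom (suc v) q ≡ motzkin L q
    IH q = rowsFrom≡motzkin L (suc v) q 1+v+L≡n
    v<n : v < n
    v<n = subst (v <_) v+1+L≡n (m<m+n v (s≤s z≤n))

  ∑<-rows-from-start : ∀ z → ∑[ m < suc n ] rows n z m 0 1 ≡ lower (rowsFrom 1) z + rowsFrom 1 z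
  ∑<-rows-from-start z = begin
      ∑[ m < suc n ] rows n z m 0 1
    ≡⟨ ∑<-cong (suc n) (λ m _ → first-value z m) ⟩
      ∑[ m < suc n ] (lower (λ q → rows n q m 1 1) z + rows n z m 1 1)
    ≡⟨ ∑<-distrib-+ (suc n) (λ m → lower (λ q → rows n q m 1 1) z) (λ m → rows n z m 1 1) ⟩
      ∑[ m < suc n ] lower (λ q → rows n q m 1 1) z + rowsFrom 1 z
    ≡⟨ cong (_+ rowsFrom 1 z) (∑<-lower 1 z) ⟩
      lower (rowsFrom 1) z + rowsFrom 1 z
    ∎
    where
    first-value : ∀ p m → rows n p m 0 1 ≡ lower (λ q → rows n q m 1 1) p + rows n p m 1 1
    first-value zero    zero    = refl
    first-value zero    (suc m) = rows-top-skip n m 0 1≤n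
    first-value (suc p) m       = rows-top-split n p m 0 1 1≤n

-- Lattice paths

double : ℕ → ℕ
double zero    = zero
double (suc k) = suc (suc (double k))

double≡+ : ∀ n → double n ≡ n + n
double≡+ zero    = refl
double≡+ (suc n) = cong suc (trans (cong suc (double≡+ n)) (sym (+-suc n n)))

-- Paths of length L with steps ±1 from height a to height b that never go below 0.
nonnegPaths : ℕ → ℕ → ℕ → ℕ
nonnegPaths zero    a       b = 𝟙 (a ≡ᵇ b)
nonnegPaths (suc L) zero    b = nonnegPaths L 1 b
nonnegPaths (suc L) (suc a) b = nonnegPaths L (suc (suc a)) b + nonnegPaths L a b

-- Each Motzkin step becomes two ±1 steps; the two kinds of level step are up-down and down-up.
motzkin≡nonnegPaths : ∀ L p → motzkin L p ≡ nonnegPaths (suc (double L)) (suc (double p)) 0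
motzkin≡nonnegPaths zero    zero    = refl
motzkin≡nonnegPaths zero    (suc p) = refl
motzkin≡nonnegPaths (suc L) zero    = begin
    0 + M 0 + (M 1 + M 0)
  ≡⟨ rearrange (M 1) (M 0) ⟩
    (M 1 + M 0) + M 0
  ≡⟨ cong₂ _+_ (cong₂ _+_ (motzkin≡nonnegPaths L 1) (motzkin≡nonnegPaths L 0)) (motzkin≡nonnegPaths L 0) ⟩
    nonnegPaths (suc (suc (suc (double L)))) 1 0
  ∎
  where
  M = motzkin L
  rearrange : ∀ a b → 0 + b + (a + b) ≡ (a + b) + b
  rearrange = solve-∀
motzkin≡nonnegPaths (suc L) (suc p) = begin
    M p + M (suc p) + (M (suc (suc p)) + M (suc p))
  ≡⟨ rearrange (M (suc (suc p))) (M (suc p)) (M p) ⟩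
    (M (suc (suc p)) + M (suc p)) + (M (suc p) + M p)
  ≡⟨ cong₂ _+_ (cong₂ _+_ (motzkin≡nonnegPaths L (suc (suc p))) (motzkin≡nonnegPaths L (suc p)))
               (cong₂ _+_ (motzkin≡nonnegPaths L (suc p)) (motzkin≡nonnegPaths L p)) ⟩
    nonnegPaths (suc (suc (suc (double L)))) (suc (suc (suc (double p)))) 0
  ∎
  where
  M = motzkin L
  rearrange : ∀ a b c → c + b + (a + b) ≡ (a + b) + (b + c)
  rearrange = solve-∀

nonnegPaths-last : ∀ L a b → nonnegPaths (suc L) a b ≡ nonnegPaths L a (suc b) + lower (nonnegPaths L a) b
nonnegPaths-last zero    zero    zero    = refl
nonnegPaths-last zero    zero    (suc b) = refl
nonnegPaths-last zero    (suc a) zero    = sym (+-identityʳ _)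
nonnegPaths-last zero    (suc a) (suc b) = +-comm (𝟙 (suc a ≡ᵇ b)) (𝟙 (a ≡ᵇ suc b))
nonnegPaths-last (suc L) zero    b       = nonnegPaths-last L 1 b
nonnegPaths-last (suc L) (suc a) zero    =
  trans (cong₂ _+_ (nonnegPaths-last L (suc (suc a)) 0) (nonnegPaths-last L a 0))
        (drop-zeros (nonnegPaths L (suc (suc a)) 1) (nonnegPaths L a 1))
  where
  drop-zeros : ∀ x y → x + 0 + (y + 0) ≡ x + y + 0
  drop-zeros = solve-∀
nonnegPaths-last (suc L) (suc a) (suc b) =
  trans (cong₂ _+_ (nonnegPaths-last L (suc (suc a)) (suc b)) (nonnegPaths-last L a (suc b)))
        (+-interchange (nonnegPaths L (suc (suc a)) (suc (suc b))) _ _ _)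

nonnegPaths-sym : ∀ L a b → nonnegPaths L a b ≡ nonnegPaths L b a
nonnegPaths-sym zero    a       b = cong 𝟙 (≡ᵇ-sym a b)
  where
  ≡ᵇ-sym : ∀ a b → (a ≡ᵇ b) ≡ (b ≡ᵇ a)
  ≡ᵇ-sym zero    zero    = refl
  ≡ᵇ-sym zero    (suc b) = refl
  ≡ᵇ-sym (suc a) zero    = refl
  ≡ᵇ-sym (suc a) (suc b) = ≡ᵇ-sym a b
nonnegPaths-sym (suc L) zero    b = trans (nonnegPaths-sym L 1 b) (sym (trans (nonnegPaths-last L b 0) (+-identityʳ _)))
nonnegPaths-sym (suc L) (suc a) b =
  trans (cong₂ _+_ (nonnegPaths-sym L (suc (suc a)) b) (nonnegPaths-sym L a b)) (sym (nonnegPaths-last L b (suc a)))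

module _ (d : ℕ) where

  evenHeightWeight : ℕ → ℕ
  evenHeightWeight zero          = 1
  evenHeightWeight (suc zero)    = 0
  evenHeightWeight (suc (suc a)) = d * evenHeightWeight a

  -- Sum over paths of length L from height a (never below 0) of d ^ (h / 2), h the even end height.
  endWeighted : ℕ → ℕ → ℕ
  endWeighted zero    a       = evenHeightWeight a
  endWeighted (suc L) zero    = endWeighted L 1
  endWeighted (suc L) (suc a) = endWeighted L (suc (suc a)) + endWeighted L a

  -- Sum over paths of length L from height h to 0 (never below 0) of (1 + d) ^ (number of up steps from 0).
  returnWeighted : ℕ → ℕ → ℕ
  returnWeighted zero    h       = 𝟙 (h ≡ᵇ 0)
  returnWeighted (suc L) zero    = suc d * returnWeighted L 1
  returnWeighted (suc L) (suc h) = returnWeighted L (suc (suc h)) + returnWeighted L h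

  endWeighted-decomposition : ℕ → ℕ → ℕ
  endWeighted-decomposition L zero          = returnWeighted L 0
  endWeighted-decomposition L (suc zero)    = suc d * returnWeighted L 1
  endWeighted-decomposition L (suc (suc y)) = suc d * returnWeighted L (suc (suc y)) + d * endWeighted L y

  endWeighted≡decomposition : ∀ L y → endWeighted L y ≡ endWeighted-decomposition L y
  endWeighted≡decomposition zero    zero          = refl
  endWeighted≡decomposition zero    (suc zero)    = sym (*-zeroʳ (suc d))
  endWeighted≡decomposition zero    (suc (suc y)) = sym (cong (_+ d * evenHeightWeight y) (*-zeroʳ (suc d)))
  endWeighted≡decomposition (suc L) zero          = endWeighted≡decomposition L 1
  endWeighted≡decomposition (suc L) (suc zero)    = begin
      endWeighted L 2 + endWeighted L 0
    ≡⟨ cong₂ _+_ (endWeighted≡decomposition L 2) (endWeighted≡decomposition L 0) ⟩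
      suc d * returnWeighted L 2 + d * endWeighted L 0 + returnWeighted L 0
    ≡⟨ cong (λ e → suc d * returnWeighted L 2 + d * e + returnWeighted L 0) (endWeighted≡decomposition L 0) ⟩
      suc d * returnWeighted L 2 + d * returnWeighted L 0 + returnWeighted L 0
    ≡⟨ collect₁ d (returnWeighted L 2) (returnWeighted L 0) ⟩
      suc d * (returnWeighted L 2 + returnWeighted L 0)
    ∎
    where
    collect₁ : ∀ d a b → (suc d * a + d * b) + b ≡ suc d * (a + b)
    collect₁ = solve-∀
  endWeighted≡decomposition (suc L) (suc (suc zero)) = begin
      endWeighted L 3 + endWeighted L 1
    ≡⟨ cong₂ _+_ (endWeighted≡decomposition L 3) (endWeighted≡decomposition L 1) ⟩
      suc d * returnWeighted L 3 + d * endWeighted L 1 + suc d * returnWeighted L 1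
    ≡⟨ collect₂ d (returnWeighted L 3) (endWeighted L 1) (returnWeighted L 1) ⟩
      suc d * (returnWeighted L 3 + returnWeighted L 1) + d * endWeighted L 1
    ∎
    where
    collect₂ : ∀ d a b c → (suc d * a + d * b) + suc d * c ≡ suc d * (a + c) + d * b
    collect₂ = solve-∀
  endWeighted≡decomposition (suc L) (suc (suc (suc y))) = begin
      endWeighted L (4 + y) + endWeighted L (2 + y)
    ≡⟨ cong₂ _+_ (endWeighted≡decomposition L (4 + y)) (endWeighted≡decomposition L (2 + y)) ⟩
      suc d * returnWeighted L (4 + y) + d * endWeighted L (2 + y) + (suc d * returnWeighted L (2 + y) + d * endWeighted L y)
    ≡⟨ collect₃ d (returnWeighted L (4 + y)) (endWeighted L (2 + y)) (returnWeighted L (2 + y)) (endWeighted L y) ⟩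
      suc d * (returnWeighted L (4 + y) + returnWeighted L (2 + y)) + d * (endWeighted L (2 + y) + endWeighted L y)
    ∎
    where
    collect₃ : ∀ d a b c e → (suc d * a + d * b) + (suc d * c + d * e) ≡ suc d * (a + c) + d * (b + e)
    collect₃ = solve-∀

  evenHeightWeight≡∑ : ∀ K a → a ≤ double K → evenHeightWeight a ≡ ∑[ k < suc K ] (d ^ k * 𝟙 (a ≡ᵇ double k))
  evenHeightWeight≡∑ K       zero          _ = sym (cong (1 +_) (∑<-zero K (λ k _ → *-zeroʳ (d ^ suc k))))
  evenHeightWeight≡∑ K       (suc zero)    _ = sym (∑<-zero (suc K) (λ k _ → odd k))
    where
    odd : ∀ k → d ^ k * 𝟙 (1 ≡ᵇ double k) ≡ 0
    odd zero    = refl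
    odd (suc k) = *-zeroʳ (d ^ suc k)
  evenHeightWeight≡∑ (suc K) (suc (suc a)) (s≤s (s≤s a≤2K)) = begin
      d * evenHeightWeight a
    ≡⟨ cong (d *_) (evenHeightWeight≡∑ K a a≤2K) ⟩
      d * ∑[ k < suc K ] (d ^ k * 𝟙 (a ≡ᵇ double k))
    ≡⟨ sym (∑<-distribˡ (suc K) d (λ k → d ^ k * 𝟙 (a ≡ᵇ double k))) ⟩
      ∑[ k < suc K ] (d * (d ^ k * 𝟙 (a ≡ᵇ double k)))
    ≡⟨ ∑<-cong (suc K) (λ k _ → sym (*-assoc d (d ^ k) (𝟙 (a ≡ᵇ double k)))) ⟩
      0 + ∑[ k < suc K ] (d ^ suc k * 𝟙 (suc (suc a) ≡ᵇ double (suc k)))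
    ∎

  endWeighted≡∑ : ∀ K L a → L + a ≤ double K → endWeighted L a ≡ ∑[ k < suc K ] (d ^ k * nonnegPaths L a (double k))
  endWeighted≡∑ K zero    a       L+a≤2K = evenHeightWeight≡∑ K a L+a≤2K
  endWeighted≡∑ K (suc L) zero    L+a≤2K = endWeighted≡∑ K L 1 (subst (_≤ double K) (sym (+-suc L 0)) L+a≤2K)
  endWeighted≡∑ K (suc L) (suc a) L+a≤2K = begin
      endWeighted L (suc (suc a)) + endWeighted L a
    ≡⟨ cong₂ _+_ (endWeighted≡∑ K L (suc (suc a)) (subst (_≤ double K) (sym (+-suc L (suc a))) L+a≤2K))
                 (endWeighted≡∑ K L a (≤-trans (+-monoʳ-≤ L (n≤1+n a)) (≤-trans (n≤1+n (L + suc a)) L+a≤2K))) ⟩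
      ∑[ k < suc K ] (d ^ k * nonnegPaths L (suc (suc a)) (double k)) + ∑[ k < suc K ] (d ^ k * nonnegPaths L a (double k))
    ≡⟨ sym (∑<-distrib-+ (suc K) (λ k → d ^ k * nonnegPaths L (suc (suc a)) (double k)) (λ k → d ^ k * nonnegPaths L a (double k))) ⟩
      ∑[ k < suc K ] (d ^ k * nonnegPaths L (suc (suc a)) (double k) + d ^ k * nonnegPaths L a (double k))
    ≡⟨ ∑<-cong (suc K) (λ k _ → sym (*-distribˡ-+ (d ^ k) (nonnegPaths L (suc (suc a)) (double k)) (nonnegPaths L a (double k)))) ⟩
      ∑[ k < suc K ] (d ^ k * nonnegPaths (suc L) (suc a) (double k))
    ∎

module _ (n′ d : ℕ) where

  private
    n = suc n′

  ∑<-rows≡nonnegPaths : ∀ z → ∑[ m < suc n ] rows n z m 0 1 ≡ nonnegPaths (double n) (double z) 0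
  ∑<-rows≡nonnegPaths z = begin
      ∑[ m < suc n ] rows n z m 0 1
    ≡⟨ ∑<-rows-from-start n (s≤s z≤n) z ⟩
      lower (rowsFrom n (s≤s z≤n) 1) z + rowsFrom n (s≤s z≤n) 1 z
    ≡⟨ cong₂ _+_ (lower-cong z (λ q → rowsFrom≡motzkin n (s≤s z≤n) n′ 1 q refl))
                 (rowsFrom≡motzkin n (s≤s z≤n) n′ 1 z refl) ⟩
      lower (motzkin n′) z + motzkin n′ z
    ≡⟨ as-paths z ⟩
      nonnegPaths (double n) (double z) 0
    ∎
    where
    as-paths : ∀ z → lower (motzkin n′) z + motzkin n′ z ≡ nonnegPaths (double n) (double z) 0
    as-paths zero    = motzkin≡nonnegPaths n′ 0
    as-paths (suc z) = trans (+-comm (motzkin n′ z) _)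
                             (cong₂ _+_ (motzkin≡nonnegPaths n′ (suc z)) (motzkin≡nonnegPaths n′ z))

  ∑<-weightedRows≡returnWeighted : ∑[ m < suc n ] weightedRows n d m 0 0 ≡ returnWeighted d (double n) 0
  ∑<-weightedRows≡returnWeighted = begin
      ∑[ m < suc n ] weightedRows n d m 0 0
    ≡⟨ ∑<-cong (suc n) (λ m _ → weightedRows-zero n d m 0) ⟩
      ∑[ m < suc n ] ∑[ z < suc m ] (d ^ z * rows n z (m ∸ z) 0 1)
    ≡⟨ ∑<-antidiagonals n (λ z j → d ^ z * rows n z j 0 1) ⟩
      ∑[ z < suc n ] ∑[ j < suc (n ∸ z) ] (d ^ z * rows n z j 0 1)
    ≡⟨ ∑<-cong (suc n) (λ z z<1+n → ∑<-extend (suc (n ∸ z)) (suc n) (λ j → d ^ z * rows n z j 0 1) (s≤s (m∸n≤m n z))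
                                     (λ j 1+n-z≤j _ → trans (cong (d ^ z *_) (too-many-columns z j z<1+n 1+n-z≤j)) (*-zeroʳ (d ^ z)))) ⟩
      ∑[ z < suc n ] ∑[ j < suc n ] (d ^ z * rows n z j 0 1)
    ≡⟨ ∑<-cong (suc n) (λ z _ → trans (∑<-distribˡ (suc n) (d ^ z) (λ j → rows n z j 0 1))
                                      (cong (d ^ z *_) (∑<-rows≡nonnegPaths z))) ⟩
      ∑[ z < suc n ] (d ^ z * nonnegPaths (double n) (double z) 0)
    ≡⟨ ∑<-cong (suc n) (λ z _ → cong (d ^ z *_) (nonnegPaths-sym (double n) (double z) 0)) ⟩
      ∑[ z < suc n ] (d ^ z * nonnegPaths (double n) 0 (double z))
    ≡⟨ sym (endWeighted≡∑ d n (double n) 0 (≤-reflexive (+-identityʳ (double n)))) ⟩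
      endWeighted d (double n) 0
    ≡⟨ endWeighted≡decomposition d (double n) 0 ⟩
      returnWeighted d (double n) 0
    ∎
    where
    too-many-columns : ∀ z j → z < suc n → suc (n ∸ z) ≤ j → rows n z j 0 1 ≡ 0
    too-many-columns z j (s≤s z≤n′) 1+n-z≤j = rows-vanish n z j 0 1 n<z+j+0 (≤-trans (≤-trans (s≤s z≤n) 1+n-z≤j) (m≤n+m j z))
      where
      n<z+j+0 : n < z + j + 0
      n<z+j+0 = subst (n <_) (sym (+-identityʳ (z + j))) (subst (_< z + j) (m+[n∸m]≡n z≤n′) (+-monoʳ-< z 1+n-z≤j))

-- Dyck words

pattern up   = fzero
pattern down = fsuc fzero

Word : ℕ → Set
Word L = Vec (Fin 2) L

valid : ∀ {L} → ℕ → Word L → Bool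
valid h       []         = h ≡ᵇ 0
valid h       (up ∷ w)   = valid (suc h) w
valid zero    (down ∷ w) = false
valid (suc h) (down ∷ w) = valid h w

returns : ∀ {L} → ℕ → Word L → ℕ
returns h       []         = 0
returns h       (up ∷ w)   = 𝟙 (h ≡ᵇ 0) + returns (suc h) w
returns zero    (down ∷ w) = 0
returns (suc h) (down ∷ w) = returns h w

∑-valid-returns : ∀ d L h → ∑[ w ∈ vecs 2 L ] (𝟙 (valid h w) * suc d ^ returns h w) ≡ returnWeighted d L h
∑-valid-returns d zero    h = trans (+-identityʳ _) (*-identityʳ _)
∑-valid-returns d (suc L) h = begin
    ∑[ w ∈ vecs 2 (suc L) ] (𝟙 (valid h w) * suc d ^ returns h w)
  ≡⟨ ∑-vecs-suc 2 L _ ⟩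
    ∑[ w ∈ vecs 2 L ] (𝟙 (valid h (up ∷ w)) * suc d ^ returns h (up ∷ w))
      + (∑[ w ∈ vecs 2 L ] (𝟙 (valid h (down ∷ w)) * suc d ^ returns h (down ∷ w)) + 0)
  ≡⟨ cong (∑[ w ∈ vecs 2 L ] (𝟙 (valid h (up ∷ w)) * suc d ^ returns h (up ∷ w)) +_) (+-identityʳ _) ⟩
    ∑[ w ∈ vecs 2 L ] (𝟙 (valid h (up ∷ w)) * suc d ^ returns h (up ∷ w))
      + ∑[ w ∈ vecs 2 L ] (𝟙 (valid h (down ∷ w)) * suc d ^ returns h (down ∷ w))
  ≡⟨ first-step h ⟩
    returnWeighted d (suc L) h
  ∎
  where
  first-step : ∀ h → ∑[ w ∈ vecs 2 L ] (𝟙 (valid h (up ∷ w)) * suc d ^ returns h (up ∷ w))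
                       + ∑[ w ∈ vecs 2 L ] (𝟙 (valid h (down ∷ w)) * suc d ^ returns h (down ∷ w))
                     ≡ returnWeighted d (suc L) h
  first-step zero = begin
      ∑[ w ∈ vecs 2 L ] (𝟙 (valid 1 w) * (suc d * suc d ^ returns 1 w)) + ∑[ w ∈ vecs 2 L ] 0
    ≡⟨ cong₂ _+_ (∑-cong (vecs 2 L) (λ w → *-left-comm (𝟙 (valid 1 w)) (suc d) _)) (∑-zero (vecs 2 L) (λ _ → refl)) ⟩
      ∑[ w ∈ vecs 2 L ] (suc d * (𝟙 (valid 1 w) * suc d ^ returns 1 w)) + 0
    ≡⟨ trans (+-identityʳ _) (∑-distribˡ (vecs 2 L) (suc d) _) ⟩
      suc d * ∑[ w ∈ vecs 2 L ] (𝟙 (valid 1 w) * suc d ^ returns 1 w)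
    ≡⟨ cong (suc d *_) (∑-valid-returns d L 1) ⟩
      suc d * returnWeighted d L 1
    ∎
  first-step (suc h) = cong₂ _+_ (∑-valid-returns d L (suc (suc h))) (∑-valid-returns d L h)

returns-bound : ∀ {L} h (w : Word L) → valid h w ≡ true → returns h w + returns h w + h ≤ L
returns-bound         zero    []         _ = z≤n
returns-bound         zero    (down ∷ w) ()
returns-bound {suc L} zero    (up ∷ w)   v = subst (_≤ suc L) (cong suc (rearrange (returns 1 w))) (s≤s (returns-bound 1 w v))
  where
  rearrange : ∀ r → r + r + 1 ≡ r + suc r + 0
  rearrange = solve-∀
returns-bound         (suc h) (up ∷ w)   v = ≤-trans (+-monoʳ-≤ _ (n≤1+n (suc h))) (m≤n⇒m≤1+n (returns-bound (suc (suc h)) w v))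
returns-bound {suc L} (suc h) (down ∷ w) v = subst (_≤ suc L) (sym (+-suc _ h)) (s≤s (returns-bound h w v))

returns-positive : ∀ {L} (w : Word (suc L)) → valid 0 w ≡ true → 1 ≤ returns 0 w
returns-positive (up ∷ w)   _ = s≤s z≤n
returns-positive (down ∷ w) ()

stepOf : Bool → Fin 2
stepOf true  = up
stepOf false = down

wordFrom : (ℕ → Bool) → (L : ℕ) → Word L
wordFrom f zero    = []
wordFrom f (suc L) = stepOf (f 0) ∷ wordFrom (λ k → f (suc k)) L

wordFrom-cong : ∀ f g L → (∀ k → k < L → f k ≡ g k) → wordFrom f L ≡ wordFrom g L
wordFrom-cong f g zero    f≗g = refl
wordFrom-cong f g (suc L) f≗g =
  cong₂ _∷_ (cong stepOf (f≗g 0 (s≤s z≤n))) (wordFrom-cong _ _ L (λ k k<L → f≗g (suc k) (s≤s k<L)))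

wordFrom-suc : ∀ (f : ℕ → Bool) q L → wordFrom (λ k → f (q + k)) (suc L) ≡ stepOf (f q) ∷ wordFrom (λ k → f (suc q + k)) L
wordFrom-suc f q L = cong₂ _∷_ (cong (stepOf ∘ f) (+-identityʳ q)) (wordFrom-cong _ _ L (λ k _ → cong f (+-suc q k)))

wordFrom-injective : ∀ f g L → wordFrom f L ≡ wordFrom g L → ∀ k → k < L → f k ≡ g k
wordFrom-injective f g (suc L) eq zero    _         = stepOf-injective (f 0) (g 0) (cong Vec.head eq)
  where
  stepOf-injective : ∀ a b → stepOf a ≡ stepOf b → a ≡ b
  stepOf-injective true  true  _ = refl
  stepOf-injective false false _ = refl
wordFrom-injective f g (suc L) eq (suc k) (s≤s k<L) = wordFrom-injective _ _ L (cong Vec.tail eq) k k<L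

isUpAt : ∀ {L} → Word L → ℕ → Bool
isUpAt []         k       = false
isUpAt (up ∷ w)   zero    = true
isUpAt (down ∷ w) zero    = false
isUpAt (s ∷ w)    (suc k) = isUpAt w k

wordFrom-isUpAt : ∀ {L} (w : Word L) → wordFrom (isUpAt w) L ≡ w
wordFrom-isUpAt []         = refl
wordFrom-isUpAt (up ∷ w)   = cong (up ∷_) (wordFrom-isUpAt w)
wordFrom-isUpAt (down ∷ w) = cong (down ∷_) (wordFrom-isUpAt w)

pop : List ℕ → List ℕ
pop []       = []
pop (_ ∷ xs) = xs

∈-pop : ∀ {k} s → k ∈ pop s → k ∈ s
∈-pop (x ∷ s) k∈s = there k∈s

pop-below-top : ∀ {k} s → s ≡ k ∷ pop s → AllPairs _>_ s → All (_< k) (pop s)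
pop-below-top (_ ∷ _) refl (s<k ∷ _) = s<k

top : List ℕ → ℕ
top []      = 0
top (x ∷ _) = x

-- The openers before position q that are still unmatched, most recent first.
stack : (ℕ → Bool) → ℕ → List ℕ
stack o zero    = []
stack o (suc q) = if o q then q ∷ stack o q else pop (stack o q)

module _ (o : ℕ → Bool) where

  stack-opens : ∀ q → o q ≡ true → stack o (suc q) ≡ q ∷ stack o q
  stack-opens q e = cong (λ b → if b then q ∷ stack o q else pop (stack o q)) e

  stack-closes : ∀ q → o q ≡ false → stack o (suc q) ≡ pop (stack o q)
  stack-closes q e = cong (λ b → if b then q ∷ stack o q else pop (stack o q)) e

  ∈-stack : ∀ q {k} → k ∈ stack o q → k < q × o k ≡ true
  ∈-stack (suc q) k∈ with o q in oq
  ... | true with k∈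
  ...   | here refl = ≤-refl , oq
  ...   | there k∈′ = Product.map₁ m≤n⇒m≤1+n (∈-stack q k∈′)
  ∈-stack (suc q) k∈ | false = Product.map₁ m≤n⇒m≤1+n (∈-stack q (∈-pop (stack o q) k∈))

  stack-descending : ∀ q → AllPairs _>_ (stack o q)
  stack-descending zero    = []
  stack-descending (suc q) with o q
  ... | true  = All.tabulate (λ k∈ → proj₁ (∈-stack q k∈)) ∷ stack-descending q
  ... | false = pop-descending (stack o q) (stack-descending q)
    where
    pop-descending : ∀ s → AllPairs _>_ s → AllPairs _>_ (pop s)
    pop-descending []      []        = []
    pop-descending (x ∷ s) (_ ∷ s↓) = s↓

stack-cong : ∀ o o′ q → (∀ k → k < q → o k ≡ o′ k) → stack o q ≡ stack o′ q
stack-cong o o′ zero    o≗o′ = refl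
stack-cong o o′ (suc q) o≗o′ =
  cong₂ (λ b s → if b then q ∷ s else pop s) (o≗o′ q ≤-refl) (stack-cong o o′ q (λ k k<q → o≗o′ k (m≤n⇒m≤1+n k<q)))

record NonCrossingMatching (N : ℕ) (m : ℕ → ℕ) : Set where
  field
    bounded       : ∀ k → k < N → m k < N
    fixpoint-free : ∀ k → k < N → m k ≢ k
    involutive    : ∀ k → k < N → m (m k) ≡ k
    non-crossing  : ∀ i j → i < N → j < N → i < j → j < m i → m i < m j → ⊥

NonCrossingMatching-cong : ∀ {N m m′} → NonCrossingMatching N m → (∀ k → k < N → m′ k ≡ m k) → NonCrossingMatching N m′
NonCrossingMatching-cong {N} {m} {m′} μ m′≗m = record
  { bounded       = λ k k<N → subst (_< N) (sym (m′≗m k k<N)) (bounded k k<N)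
  ; fixpoint-free = λ k k<N e → fixpoint-free k k<N (trans (sym (m′≗m k k<N)) e)
  ; involutive    = λ k k<N → trans (m′≗m (m′ k) (subst (_< N) (sym (m′≗m k k<N)) (bounded k k<N)))
                                    (trans (cong m (m′≗m k k<N)) (involutive k k<N))
  ; non-crossing  = λ i j i<N j<N i<j j<m′i m′i<m′j →
      non-crossing i j i<N j<N i<j (subst (j <_) (m′≗m i i<N) j<m′i) (subst₂ _<_ (m′≗m i i<N) (m′≗m j j<N) m′i<m′j)
  }
  where open NonCrossingMatching μ

opens : (ℕ → ℕ) → ℕ → Bool
opens m k = suc k ≤ᵇ m k

module Scan {N : ℕ} {m : ℕ → ℕ} (μ : NonCrossingMatching N m) where

  open NonCrossingMatching μ

  private
    o = opens m

  opens⇒< : ∀ k → o k ≡ true → k < m k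
  opens⇒< k = ≤ᵇ⇒≤ (suc k) (m k)

  closes⇒> : ∀ k → k < N → o k ≡ false → m k < k
  closes⇒> k k<N ok with <-cmp (m k) k
  ... | tri< mk<k _ _ = mk<k
  ... | tri≈ _ mk≡k _ = contradiction mk≡k (fixpoint-free k k<N)
  ... | tri> _ _ k<mk = contradiction (trans (sym (≤⇒≤ᵇ k<mk)) ok) (λ ())

  OpenAt : ℕ → ℕ → Set
  OpenAt q k = k < q × k < m k × q ≤ m k

  ListsOpen : ℕ → List ℕ → Set
  ListsOpen q s = ∀ k → (k ∈ s → OpenAt q k) × (OpenAt q k → k ∈ s)

  partner-open : ∀ q → q < N → o q ≡ false → OpenAt q (m q)
  partner-open q q<N oq = closes⇒> q q<N oq , subst (m q <_) (sym (involutive q q<N)) (closes⇒> q q<N oq)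
                        , ≤-reflexive (sym (involutive q q<N))

  closer-on-top : ∀ q → q < N → o q ≡ false → (s : List ℕ) → ListsOpen q s → AllPairs _>_ s → s ≡ m q ∷ pop s
  closer-on-top q q<N oq []       lists _ with () ← proj₂ (lists (m q)) (partner-open q q<N oq)
  closer-on-top q q<N oq (k ∷ s′) lists (s′<k ∷ _) with proj₂ (lists (m q)) (partner-open q q<N oq)
  ... | here refl  = refl
  ... | there mq∈s =
        ⊥-elim (non-crossing (m q) k mq<N k<N (All.lookup s′<k mq∈s) k<m[mq] m[mq]<mk)
    where
    k-open = proj₁ (lists k) (here refl)
    mq<N   = <-trans (closes⇒> q q<N oq) q<N
    k<N    = <-trans (proj₁ k-open) q<N
    k<m[mq] : k < m (m q)
    k<m[mq] = subst (k <_) (sym (involutive q q<N)) (proj₁ k-open)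
    m[mq]<mk : m (m q) < m k
    m[mq]<mk with m≤n⇒m<n∨m≡n (proj₂ (proj₂ k-open))
    ... | inj₁ q<mk = subst (_< m k) (sym (involutive q q<N)) q<mk
    ... | inj₂ q≡mk = contradiction (trans (cong m q≡mk) (involutive k k<N)) (<⇒≢ (All.lookup s′<k mq∈s))

  stack-lists-open : ∀ q → q ≤ N → ListsOpen q (stack o q)
  stack-lists-open zero    _     k = (λ ()) , (λ ())
  stack-lists-open (suc q) 1+q≤N k with o q in oq
  ... | true = to , from
    where
    IH = stack-lists-open q (<⇒≤ 1+q≤N)
    to : k ∈ q ∷ stack o q → OpenAt (suc q) k
    to (here refl) = ≤-refl , opens⇒< q oq , opens⇒< q oq
    to (there k∈) with proj₁ (IH k) k∈
    ... | k<q , k<mk , q≤mk with m≤n⇒m<n∨m≡n q≤mk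
    ...   | inj₁ q<mk = m≤n⇒m≤1+n k<q , k<mk , q<mk
    ...   | inj₂ q≡mk = contradiction (subst (q <_) (trans (cong m q≡mk) (involutive k (<-trans k<q 1+q≤N))) (opens⇒< q oq)) (<⇒≯ k<q)
    from : OpenAt (suc q) k → k ∈ q ∷ stack o q
    from (k<1+q , k<mk , 1+q≤mk) with m≤n⇒m<n∨m≡n k<1+q
    ... | inj₂ 1+k≡1+q = here (suc-injective 1+k≡1+q)
    ... | inj₁ 1+k<1+q = there (proj₂ (IH k) (≤-pred 1+k<1+q , k<mk , <⇒≤ 1+q≤mk))
  ... | false = to , from
    where
    IH = stack-lists-open q (<⇒≤ 1+q≤N)
    on-top = closer-on-top q 1+q≤N oq (stack o q) IH (stack-descending o q)
    below-top : All (_< m q) (pop (stack o q))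
    below-top with stack o q | on-top | stack-descending o q
    ... | _ ∷ _ | refl | s<top ∷ _ = s<top
    to : k ∈ pop (stack o q) → OpenAt (suc q) k
    to k∈ with proj₁ (IH k) (∈-pop (stack o q) k∈)
    ... | k<q , k<mk , q≤mk with m≤n⇒m<n∨m≡n q≤mk
    ...   | inj₁ q<mk = m≤n⇒m≤1+n k<q , k<mk , q<mk
    ...   | inj₂ q≡mk = contradiction (trans (sym (involutive k (<-trans k<q 1+q≤N))) (cong m (sym q≡mk)))
                                      (<⇒≢ (All.lookup below-top k∈))
    from : OpenAt (suc q) k → k ∈ pop (stack o q)
    from (k<1+q , k<mk , 1+q≤mk) with m≤n⇒m<n∨m≡n k<1+q
    ... | inj₂ 1+k≡1+q = contradiction (subst (λ z → z < m z) (suc-injective 1+k≡1+q) k<mk) (<⇒≯ (closes⇒> q 1+q≤N oq))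
    ... | inj₁ 1+k<1+q with subst (k ∈_) on-top (proj₂ (IH k) (≤-pred 1+k<1+q , k<mk , <⇒≤ 1+q≤mk))
    ...   | here k≡mq  = contradiction (trans (cong m k≡mq) (involutive q 1+q≤N)) (<⇒≢ 1+q≤mk ∘ sym)
    ...   | there k∈  = k∈

  stack-at-end : stack o N ≡ []
  stack-at-end with stack o N | stack-lists-open N ≤-refl
  ... | []    | _     = refl
  ... | k ∷ _ | lists with proj₁ (lists k) (here refl)
  ...   | k<N , _ , N≤mk = contradiction (bounded k k<N) (≤⇒≯ N≤mk)

  closer-pops : ∀ q → q < N → o q ≡ false → stack o q ≡ m q ∷ pop (stack o q)
  closer-pops q q<N oq = closer-on-top q q<N oq (stack o q) (stack-lists-open q (<⇒≤ q<N)) (stack-descending o q)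

  valid-scan : ∀ L q → q + L ≡ N → valid (length (stack o q)) (wordFrom (λ k → o (q + k)) L) ≡ true
  valid-scan zero q q+0≡N rewrite trans (sym (+-identityʳ q)) q+0≡N | stack-at-end = refl
  valid-scan (suc L) q q+1+L≡N rewrite wordFrom-suc o q L with o q in oq
  ... | true  = subst (λ s → valid (length s) (wordFrom (λ k → o (suc q + k)) L) ≡ true) (stack-opens o q oq) IH
    where IH = valid-scan L (suc q) (trans (sym (+-suc q L)) q+1+L≡N)
  ... | false rewrite closer-pops q (subst (q <_) q+1+L≡N (m<m+n q (s≤s z≤n))) oq =
        subst (λ s → valid (length s) (wordFrom (λ k → o (suc q + k)) L) ≡ true) (stack-closes o q oq) IH
    where IH = valid-scan L (suc q) (trans (sym (+-suc q L)) q+1+L≡N)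

  returns-scan : ∀ L q → q + L ≡ N →
    returns (length (stack o q)) (wordFrom (λ k → o (q + k)) L) ≡ ∑[ k < L ] 𝟙 (o (q + k) ∧ null (stack o (q + k)))
  returns-scan zero    q _         = refl
  returns-scan (suc L) q q+1+L≡N = begin
      returns (length (stack o q)) (wordFrom (λ k → o (q + k)) (suc L))
    ≡⟨ cong (returns (length (stack o q))) (wordFrom-suc o q L) ⟩
      returns (length (stack o q)) (stepOf (o q) ∷ rest)
    ≡⟨ first-step (o q) refl ⟩
      𝟙 (o q ∧ null (stack o q)) + ∑[ k < L ] 𝟙 (o (suc q + k) ∧ null (stack o (suc q + k)))
    ≡⟨ sym (cong₂ _+_ (cong exposedAt (+-identityʳ q)) (∑<-cong L (λ k _ → cong exposedAt (+-suc q k)))) ⟩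
      ∑[ k < suc L ] 𝟙 (o (q + k) ∧ null (stack o (q + k)))
    ∎
    where
    rest = wordFrom (λ k → o (suc q + k)) L
    exposedAt : ℕ → ℕ
    exposedAt p = 𝟙 (o p ∧ null (stack o p))
    IH = returns-scan L (suc q) (trans (sym (+-suc q L)) q+1+L≡N)
    length≡ᵇ0 : ∀ (s : List ℕ) → (length s ≡ᵇ 0) ≡ null s
    length≡ᵇ0 []      = refl
    length≡ᵇ0 (_ ∷ _) = refl
    first-step : ∀ b → o q ≡ b →
      returns (length (stack o q)) (stepOf b ∷ rest) ≡ 𝟙 (b ∧ null (stack o q)) + ∑[ k < L ] exposedAt (suc q + k)
    first-step true  oq = cong₂ _+_ (cong 𝟙 (length≡ᵇ0 (stack o q)))
                                    (subst (λ s → returns (length s) rest ≡ ∑[ k < L ] exposedAt (suc q + k)) (stack-opens o q oq) IH)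
    first-step false oq rewrite closer-pops q (subst (q <_) q+1+L≡N (m<m+n q (s≤s z≤n))) oq =
      subst (λ s → returns (length s) rest ≡ ∑[ k < L ] exposedAt (suc q + k)) (stack-closes o q oq) IH

  exposed⇒top-level : ∀ k → k < N → k < m k → (∀ j → j < N → j < k → m k < m j → ⊥) → T (o k ∧ null (stack o k))
  exposed⇒top-level k k<N k<mk not-nested rewrite ≤⇒≤ᵇ k<mk = empty (stack o k) refl
    where
    empty : ∀ s → s ≡ stack o k → T (null s)
    empty []      _  = _
    empty (j ∷ _) eq with proj₁ (stack-lists-open k (<⇒≤ k<N) j) (subst (j ∈_) eq (here refl))
    ... | j<k , j<mj , k≤mj = not-nested j j<N j<k mk<mj
      where
      j<N = <-trans j<k k<N
      k<mj : k < m j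
      k<mj with m≤n⇒m<n∨m≡n k≤mj
      ... | inj₁ k<mj = k<mj
      ... | inj₂ k≡mj = contradiction (subst (k <_) (trans (cong m k≡mj) (involutive j j<N)) k<mk) (<⇒≯ j<k)
      mk<mj : m k < m j
      mk<mj with <-cmp (m k) (m j)
      ... | tri< mk<mj _ _ = mk<mj
      ... | tri≈ _ mk≡mj _ = contradiction (trans (sym (involutive j j<N)) (trans (cong m (sym mk≡mj)) (involutive k k<N))) (<⇒≢ j<k)
      ... | tri> _ _ mj<mk = ⊥-elim (non-crossing j k j<N k<N j<k k<mj mj<mk)

  top-level⇒exposed : ∀ k → k < N → T (o k ∧ null (stack o k)) → k < m k × (∀ j → j < N → j < k → m k < m j → ⊥)
  top-level⇒exposed k k<N t with o k in ok
  ... | true = opens⇒< k ok , λ j j<N j<k mk<mj →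
                 ∉-empty (stack o k) t (proj₂ (stack-lists-open k (<⇒≤ k<N) j)
                   (j<k , <-trans j<k (<-trans (opens⇒< k ok) mk<mj) , <⇒≤ (<-trans (opens⇒< k ok) mk<mj)))
    where
    ∉-empty : ∀ {j} s → T (null s) → j ∈ s → ⊥
    ∉-empty (_ ∷ _) () _

-- A closer is matched with the top of the stack, so the openers determine the matching.
opens-injective : ∀ {N m m′} → NonCrossingMatching N m → NonCrossingMatching N m′ →
                  (∀ k → k < N → opens m k ≡ opens m′ k) → ∀ k → k < N → m k ≡ m′ k
opens-injective {N} {m} {m′} μ μ′ same = matched
  where
  open NonCrossingMatching
  closer-matched : ∀ q → q < N → opens m q ≡ false → m q ≡ m′ q
  closer-matched q q<N oq = begin
    m q                         ≡⟨ sym (cong top (Scan.closer-pops μ q q<N oq)) ⟩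
    top (stack (opens m) q)     ≡⟨ cong top (stack-cong (opens m) (opens m′) q (λ k k<q → same k (<-trans k<q q<N))) ⟩
    top (stack (opens m′) q)    ≡⟨ cong top (Scan.closer-pops μ′ q q<N (trans (sym (same q q<N)) oq)) ⟩
    m′ q                        ∎
  matched : ∀ k → k < N → m k ≡ m′ k
  matched k k<N with opens m k in ok
  ... | false = closer-matched k k<N ok
  ... | true  = begin
      m k              ≡⟨ sym (involutive μ′ (m k) (bounded μ k k<N)) ⟩
      m′ (m′ (m k))    ≡⟨ cong m′ (sym (closer-matched (m k) (bounded μ k k<N) partner-closes)) ⟩
      m′ (m (m k))     ≡⟨ cong m′ (involutive μ k k<N) ⟩
      m′ k             ∎
    where
    partner-closes : opens m (m k) ≡ false
    partner-closes = trans (cong (suc (m k) ≤ᵇ_) (involutive μ k k<N)) (>⇒≤ᵇ (m≤n⇒m≤1+n (Scan.opens⇒< μ k ok)))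

module Matching (N : ℕ) (o : ℕ → Bool) (o-valid : valid 0 (wordFrom o N) ≡ true) where

  valid-suffix : ∀ q L → q + L ≡ N → valid (length (stack o q)) (wordFrom (λ k → o (q + k)) L) ≡ true
  valid-suffix zero    L L≡N = subst (λ L → valid 0 (wordFrom o L) ≡ true) (sym L≡N) o-valid
  valid-suffix (suc q) L q+1+L≡N = step (o q) (stack o q) refl refl prev
    where
    rest = wordFrom (λ k → o (suc q + k)) L
    prev : valid (length (stack o q)) (stepOf (o q) ∷ rest) ≡ true
    prev = trans (sym (cong (valid (length (stack o q))) (wordFrom-suc o q L))) (valid-suffix q (suc L) (trans (+-suc q L) q+1+L≡N))
    step : ∀ b s → o q ≡ b → stack o q ≡ s → valid (length s) (stepOf b ∷ rest) ≡ true →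
           valid (length (stack o (suc q))) rest ≡ true
    step true  s       oq sq v = subst (λ s → valid (length s) rest ≡ true) (sym (trans (stack-opens o q oq) (cong (q ∷_) sq))) v
    step false (k ∷ s) oq sq v = subst (λ s → valid (length s) rest ≡ true) (sym (trans (stack-closes o q oq) (cong pop sq))) v

  closer-has-top : ∀ q → q < N → o q ≡ false → stack o q ≡ top (stack o q) ∷ pop (stack o q)
  closer-has-top q q<N oq = nonempty (o q) (stack o q) refl v
    where
    rest = wordFrom (λ k → o (suc q + k)) (N ∸ suc q)
    v : valid (length (stack o q)) (stepOf (o q) ∷ rest) ≡ true
    v = trans (sym (cong (valid (length (stack o q))) (wordFrom-suc o q (N ∸ suc q))))
              (valid-suffix q (suc (N ∸ suc q)) (trans (+-suc q (N ∸ suc q)) (m+[n∸m]≡n q<N)))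
    nonempty : ∀ b s → o q ≡ b → valid (length s) (stepOf b ∷ rest) ≡ true → s ≡ top s ∷ pop s
    nonempty true  s       oq′ _ = contradiction (trans (sym oq) oq′) (λ ())
    nonempty false (k ∷ s) _   _ = refl

  stack-at-end : stack o N ≡ []
  stack-at-end = empty (stack o N) (valid-suffix N 0 (+-identityʳ N))
    where
    empty : ∀ s → (length s ≡ᵇ 0) ≡ true → s ≡ []
    empty [] _ = refl

  ClosesAt : ℕ → ℕ → Set
  ClosesAt k j = o j ≡ false × stack o j ≡ k ∷ pop (stack o j)

  closes? : ∀ k j → Dec (ClosesAt k j)
  closes? k j = (o j Bool.≟ false) ×-dec ≡-dec _≟_ (stack o j) (k ∷ pop (stack o j))

  closing-in-stack : ∀ {k j} → ClosesAt k j → k ∈ stack o j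
  closing-in-stack (_ , sj) = subst (_ ∈_) (sym sj) (here refl)

  closing-removes : ∀ {k j} → ClosesAt k j → k ∉ stack o (suc j)
  closing-removes {k} {j} (oj , sj) k∈ =
    <-irrefl refl (All.lookup (pop-below-top (stack o j) sj (stack-descending o j)) (subst (k ∈_) (stack-closes o j oj) k∈))

  stays : ∀ {k b} → k ∈ stack o b → ¬ ClosesAt k b → k ∈ stack o (suc b)
  stays {k} {b} k∈ not-closed with o b in ob
  ... | true  = there k∈
  ... | false = below-top (stack o b) refl k∈
    where
    below-top : ∀ s → s ≡ stack o b → k ∈ s → k ∈ pop (stack o b)
    below-top (h ∷ t) sb (here k≡h) = contradiction (refl , trans (sym sb) (cong₂ _∷_ (sym k≡h) (cong pop sb))) not-closed
    below-top (h ∷ t) sb (there k∈t) = subst (k ∈_) (cong pop sb) k∈t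

  stays-during : ∀ {k} L a → k ∈ stack o a → (∀ b → a ≤ b → b < a + L → ¬ ClosesAt k b) → k ∈ stack o (a + L)
  stays-during {k} zero    a k∈ _          = subst (λ p → k ∈ stack o p) (sym (+-identityʳ a)) k∈
  stays-during {k} (suc L) a k∈ not-closed = subst (λ p → k ∈ stack o p) (sym (+-suc a L))
    (stays-during L (suc a) (stays k∈ (not-closed a ≤-refl (m<m+n a (s≤s z≤n))))
      (λ b a<b b<1+a+L → not-closed b (<⇒≤ a<b) (subst (b <_) (sym (+-suc a L)) b<1+a+L)))

  stays-away : ∀ {k} L a → k ∉ stack o a → k < a → k ∉ stack o (a + L)
  stays-away {k} zero    a k∉ _   = subst (λ p → k ∉ stack o p) (sym (+-identityʳ a)) k∉
  stays-away {k} (suc L) a k∉ k<a = subst (λ p → k ∉ stack o p) (sym (+-suc a L))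
    (stays-away L (suc a) step (m≤n⇒m≤1+n k<a))
    where
    step : k ∉ stack o (suc a)
    step k∈ with o a
    step (here refl)  | true  = <-irrefl refl k<a
    step (there k∈′)  | true  = k∉ k∈′
    step k∈           | false = k∉ (∈-pop (stack o a) k∈)

  closes-once : ∀ {k j₁ j₂} → ClosesAt k j₁ → ClosesAt k j₂ → j₁ < j₂ → ⊥
  closes-once {k} {j₁} {j₂} c₁ c₂ j₁<j₂ =
    stays-away (j₂ ∸ suc j₁) (suc j₁) (closing-removes c₁) (m≤n⇒m≤1+n (proj₁ (∈-stack o j₁ (closing-in-stack c₁))))
               (subst (λ p → k ∈ stack o p) (sym (m+[n∸m]≡n j₁<j₂)) (closing-in-stack c₂))

  closes-unique : ∀ {k j₁ j₂} → ClosesAt k j₁ → ClosesAt k j₂ → j₁ ≡ j₂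
  closes-unique {k} {j₁} {j₂} c₁ c₂ with <-cmp j₁ j₂
  ... | tri< j₁<j₂ _ _ = ⊥-elim (closes-once c₁ c₂ j₁<j₂)
  ... | tri≈ _ j₁≡j₂ _ = j₁≡j₂
  ... | tri> _ _ j₂<j₁ = ⊥-elim (closes-once c₂ c₁ j₂<j₁)

  partner : ℕ → ℕ
  partner k with any? (λ (j : Fin N) → closes? k (toℕ j))
  ... | yes (j , _) = toℕ j
  ... | no _        = 0

  opener-in-stack : ∀ k → o k ≡ true → k ∈ stack o (suc k)
  opener-in-stack k ok = subst (k ∈_) (sym (stack-opens o k ok)) (here refl)

  partner-closes : ∀ k → o k ≡ true → k < N → partner k < N × ClosesAt k (partner k)
  partner-closes k ok k<N with any? (λ (j : Fin N) → closes? k (toℕ j))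
  ... | yes (j , c) = toℕ<n j , c
  ... | no  none    = contradiction (subst (k ∈_) stack-at-end k∈stack-N) (λ ())
    where
    k∈stack-N : k ∈ stack o N
    k∈stack-N = subst (λ p → k ∈ stack o p) (m+[n∸m]≡n k<N)
      (stays-during (N ∸ suc k) (suc k) (opener-in-stack k ok) (λ b _ b<N c →
        none (fromℕ< (subst (b <_) (m+[n∸m]≡n k<N) b<N) , subst (ClosesAt k) (sym (toℕ-fromℕ< _)) c)))

  opener<partner : ∀ k → o k ≡ true → k < N → k < partner k
  opener<partner k ok k<N = proj₁ (∈-stack o (partner k) (closing-in-stack (proj₂ (partner-closes k ok k<N))))

  match : ℕ → ℕ
  match q = if o q then partner q else top (stack o q)

  match-opener : ∀ q → o q ≡ true → match q ≡ partner q
  match-opener q oq = cong (λ b → if b then partner q else top (stack o q)) oq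

  match-closer : ∀ q → o q ≡ false → match q ≡ top (stack o q)
  match-closer q oq = cong (λ b → if b then partner q else top (stack o q)) oq

  closer-top : ∀ q → q < N → o q ≡ false → top (stack o q) < q × o (top (stack o q)) ≡ true × ClosesAt (top (stack o q)) q
  closer-top q q<N oq = proj₁ top∈ , proj₂ top∈ , oq , closer-has-top q q<N oq
    where top∈ = ∈-stack o q (subst (top (stack o q) ∈_) (sym (closer-has-top q q<N oq)) (here refl))

  opens-match : ∀ k → k < N → opens match k ≡ o k
  opens-match k k<N with o k in ok
  ... | true  = ≤⇒≤ᵇ (opener<partner k ok k<N)
  ... | false = >⇒≤ᵇ (m≤n⇒m≤1+n (proj₁ (closer-top k k<N ok)))

  match-bounded : ∀ k → k < N → match k < N
  match-bounded k k<N with o k in ok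
  ... | true  = proj₁ (partner-closes k ok k<N)
  ... | false = <-trans (proj₁ (closer-top k k<N ok)) k<N

  match-fixpoint-free : ∀ k → k < N → match k ≢ k
  match-fixpoint-free k k<N with o k in ok
  ... | true  = >⇒≢ (opener<partner k ok k<N)
  ... | false = <⇒≢ (proj₁ (closer-top k k<N ok))

  match-involutive : ∀ k → k < N → match (match k) ≡ k
  match-involutive k k<N with o k in ok
  ... | true  = trans (match-closer (partner k) (proj₁ closes)) (cong top (proj₂ closes))
    where closes = proj₂ (partner-closes k ok k<N)
  ... | false = trans (match-opener h oh) (closes-unique (proj₂ (partner-closes h oh (<-trans h<k k<N))) h-closes)
    where
    h = top (stack o k)
    h<k = proj₁ (closer-top k k<N ok)
    oh = proj₁ (proj₂ (closer-top k k<N ok))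
    h-closes = proj₂ (proj₂ (closer-top k k<N ok))

  -- An arc opened between i and its partner is still open when i closes, yet i must then be on top.
  nested-openers : ∀ i j → i < N → j < N → o i ≡ true → o j ≡ true → i < j → j < partner i → partner i < partner j → ⊥
  nested-openers i j i<N j<N oi oj i<j j<t t<pj = at-top (subst (j ∈_) (proj₂ closes-i) j∈stack-t)
    where
    t = partner i
    closes-i = proj₂ (partner-closes i oi i<N)
    j∈stack-t : j ∈ stack o t
    j∈stack-t = subst (λ p → j ∈ stack o p) (m+[n∸m]≡n j<t)
      (stays-during (t ∸ suc j) (suc j) (opener-in-stack j oj) (λ b _ b<t c →
        <-irrefl (closes-unique c (proj₂ (partner-closes j oj j<N))) (<-trans (subst (b <_) (m+[n∸m]≡n j<t) b<t) t<pj)))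
    at-top : j ∈ i ∷ pop (stack o t) → ⊥
    at-top (here j≡i)  = <-irrefl (sym j≡i) i<j
    at-top (there j∈s) = <-asym i<j (All.lookup (pop-below-top (stack o t) (proj₂ closes-i) (stack-descending o t)) j∈s)

  match-non-crossing : ∀ i j → i < N → j < N → i < j → j < match i → match i < match j → ⊥
  match-non-crossing i j i<N j<N i<j j<mi mi<mj with o i in oi | o j in oj
  ... | false | _     = <-asym (<-trans (proj₁ (closer-top i i<N oi)) i<j) j<mi
  ... | true  | false = <-asym (<-trans (proj₁ (closer-top j j<N oj)) j<mi) mi<mj
  ... | true  | true  = nested-openers i j i<N j<N oi oj i<j j<mi mi<mj

  match-noncrossing : NonCrossingMatching N match
  match-noncrossing = record
    { bounded = match-bounded ; fixpoint-free = match-fixpoint-free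
    ; involutive = match-involutive ; non-crossing = match-non-crossing }

lookupℕ : ∀ {N L} → Vec (Fin N) L → ℕ → ℕ
lookupℕ []      k       = 0
lookupℕ (x ∷ v) zero    = toℕ x
lookupℕ (x ∷ v) (suc k) = lookupℕ v k

lookupℕ-toℕ : ∀ {N L} (v : Vec (Fin N) L) (i : Fin L) → lookupℕ v (toℕ i) ≡ toℕ (lookup v i)
lookupℕ-toℕ (x ∷ v) fzero    = refl
lookupℕ-toℕ (x ∷ v) (fsuc i) = lookupℕ-toℕ v i

lookupℕ-fromℕ< : ∀ {N L} (v : Vec (Fin N) L) {k} (k<L : k < L) → lookupℕ v k ≡ toℕ (lookup v (fromℕ< k<L))
lookupℕ-fromℕ< v k<L = trans (cong (lookupℕ v) (sym (toℕ-fromℕ< k<L))) (lookupℕ-toℕ v (fromℕ< k<L))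

lookupℕ-injective : ∀ {N L} (u v : Vec (Fin N) L) → (∀ k → k < L → lookupℕ u k ≡ lookupℕ v k) → u ≡ v
lookupℕ-injective []      []      _   = refl
lookupℕ-injective (x ∷ u) (y ∷ v) u≗v =
  cong₂ _∷_ (toℕ-injective (u≗v 0 (s≤s z≤n))) (lookupℕ-injective u v (λ k k<L → u≗v (suc k) (s≤s k<L)))

tabulateℕ : ∀ {N} (M : ℕ → ℕ) → (∀ k → k < N → M k < N) → Vec (Fin N) N
tabulateℕ M bounded = Vec.tabulate (λ i → fromℕ< (bounded (toℕ i) (toℕ<n i)))

lookupℕ-tabulateℕ : ∀ {N} M (bounded : ∀ k → k < N → M k < N) k → k < N → lookupℕ (tabulateℕ M bounded) k ≡ M k
lookupℕ-tabulateℕ M bounded k k<N = begin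
  lookupℕ (tabulateℕ M bounded) k                          ≡⟨ lookupℕ-fromℕ< (tabulateℕ M bounded) k<N ⟩
  toℕ (lookup (tabulateℕ M bounded) (fromℕ< k<N))          ≡⟨ cong toℕ (lookup∘tabulate _ (fromℕ< k<N)) ⟩
  toℕ (fromℕ< (bounded (toℕ (fromℕ< k<N)) (toℕ<n _)))      ≡⟨ toℕ-fromℕ< _ ⟩
  M (toℕ (fromℕ< k<N))                                     ≡⟨ cong M (toℕ-fromℕ< k<N) ⟩
  M k                                                      ∎

module _ (n : ℕ) (μ : Vec (Pos n) (n + n)) where

  private
    N = n + n
    m = lookupℕ μ

  IsTL⇒NonCrossingMatching : IsTL n μ → NonCrossingMatching N m
  IsTL⇒NonCrossingMatching (fixpoint-free , involutive , non-crossing) = record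
    { bounded       = λ k k<N → subst (_< N) (sym (lookupℕ-fromℕ< μ k<N)) (toℕ<n _)
    ; fixpoint-free = λ k k<N mk≡k → fixpoint-free (fromℕ< k<N) (toℕ-injective
        (trans (sym (lookupℕ-fromℕ< μ k<N)) (trans mk≡k (sym (toℕ-fromℕ< k<N)))))
    ; involutive    = λ k k<N → begin
        m (m k)                                         ≡⟨ cong m (lookupℕ-fromℕ< μ k<N) ⟩
        m (toℕ (lookup μ (fromℕ< k<N)))                 ≡⟨ lookupℕ-toℕ μ _ ⟩
        toℕ (lookup μ (lookup μ (fromℕ< k<N)))          ≡⟨ cong toℕ (involutive (fromℕ< k<N)) ⟩
        toℕ (fromℕ< k<N)                                ≡⟨ toℕ-fromℕ< k<N ⟩
        k                                               ∎
    ; non-crossing  = λ a b a<N b<N a<b b<ma ma<mb → non-crossing (fromℕ< a<N , fromℕ< b<N ,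
        subst₂ _<_ (sym (toℕ-fromℕ< a<N)) (sym (toℕ-fromℕ< b<N)) a<b ,
        subst₂ _<_ (sym (toℕ-fromℕ< b<N)) (lookupℕ-fromℕ< μ a<N) b<ma ,
        subst₂ _<_ (lookupℕ-fromℕ< μ a<N) (lookupℕ-fromℕ< μ b<N) ma<mb)
    }

  NonCrossingMatching⇒IsTL : NonCrossingMatching N m → IsTL n μ
  NonCrossingMatching⇒IsTL μ′ = fixpoint-free′ , involutive′ , non-crossing′
    where
    open NonCrossingMatching μ′
    fixpoint-free′ : ∀ i → lookup μ i ≢ i
    fixpoint-free′ i μi≡i = fixpoint-free (toℕ i) (toℕ<n i) (trans (lookupℕ-toℕ μ i) (cong toℕ μi≡i))
    involutive′ : ∀ i → lookup μ (lookup μ i) ≡ i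
    involutive′ i = toℕ-injective (begin
      toℕ (lookup μ (lookup μ i))   ≡⟨ sym (lookupℕ-toℕ μ (lookup μ i)) ⟩
      m (toℕ (lookup μ i))          ≡⟨ cong m (sym (lookupℕ-toℕ μ i)) ⟩
      m (m (toℕ i))                 ≡⟨ involutive (toℕ i) (toℕ<n i) ⟩
      toℕ i                         ∎)
    non-crossing′ : ¬ (∃[ i ] ∃[ j ] (toℕ i < toℕ j) × (toℕ j < toℕ (lookup μ i)) × (toℕ (lookup μ i) < toℕ (lookup μ j)))
    non-crossing′ (i , j , i<j , j<μi , μi<μj) = non-crossing (toℕ i) (toℕ j) (toℕ<n i) (toℕ<n j) i<j
      (subst (toℕ j <_) (sym (lookupℕ-toℕ μ i)) j<μi) (subst₂ _<_ (sym (lookupℕ-toℕ μ i)) (sym (lookupℕ-toℕ μ j)) μi<μj)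

-- TL-diagrams as Dyck words

𝟙-does-* : {P Q R : Set} (P? : Dec P) (Q? : Dec Q) (R? : Dec R) → (P → Q → R) → (R → P × Q) →
           𝟙 (does P?) * 𝟙 (does Q?) ≡ 𝟙 (does R?)
𝟙-does-* (yes p) (yes q) R? to from = sym (cong 𝟙 (dec-true R? (to p q)))
𝟙-does-* (yes p) (no ¬q) R? to from = sym (cong 𝟙 (dec-false R? (¬q ∘ proj₂ ∘ from)))
𝟙-does-* (no ¬p) Q?      R? to from = sym (cong 𝟙 (dec-false R? (¬p ∘ proj₁ ∘ from)))

_≟ᵥ_ : ∀ {K L} → (u v : Vec (Fin K) L) → Dec (u ≡ v)
_≟ᵥ_ = Vecₚ.≡-dec Finₚ._≟_

module _ (n : ℕ) where

  private
    N = n + n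

  wordOf : Vec (Pos n) N → Word N
  wordOf μ = wordFrom (opens (lookupℕ μ)) N

  wordOf-valid : ∀ μ → IsTL n μ → valid 0 (wordOf μ) ≡ true
  wordOf-valid μ tl = Scan.valid-scan (IsTL⇒NonCrossingMatching n μ tl) N 0 refl

  exposed≡returns : ∀ μ → IsTL n μ → exposed n μ ≡ returns 0 (wordOf μ)
  exposed≡returns μ tl = begin
      exposed n μ
    ≡⟨ length-filter≡∑ (isExposedLeftEnd? n μ) (allFin N) ⟩
      ∑[ i ∈ allFin N ] 𝟙 (does (isExposedLeftEnd? n μ i))
    ≡⟨ ∑-cong (allFin N) (λ i → cong 𝟙 (does-⇔ (isExposedLeftEnd? n μ i) _ (to i) (from i))) ⟩
      ∑[ i ∈ allFin N ] 𝟙 (o (toℕ i) ∧ null (stack o (toℕ i)))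
    ≡⟨ ∑-allFin-toℕ N (λ k → 𝟙 (o k ∧ null (stack o k))) ⟩
      ∑[ k < N ] 𝟙 (o k ∧ null (stack o k))
    ≡⟨ sym (Scan.returns-scan m N 0 refl) ⟩
      returns 0 (wordOf μ)
    ∎
    where
    m = IsTL⇒NonCrossingMatching n μ tl
    o = opens (lookupℕ μ)
    to : ∀ i → IsExposedLeftEnd n μ i → T (o (toℕ i) ∧ null (stack o (toℕ i)))
    to i (i<μi , not-nested) = Scan.exposed⇒top-level m (toℕ i) (toℕ<n i) (subst (toℕ i <_) (sym (lookupℕ-toℕ μ i)) i<μi)
      (λ j j<N j<i μi<μj → not-nested (fromℕ< j<N , subst (_< toℕ i) (sym (toℕ-fromℕ< j<N)) j<i ,
         subst₂ _<_ (lookupℕ-toℕ μ i) (lookupℕ-fromℕ< μ j<N) μi<μj))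
    from : ∀ i → T (o (toℕ i) ∧ null (stack o (toℕ i))) → IsExposedLeftEnd n μ i
    from i t with Scan.top-level⇒exposed m (toℕ i) (toℕ<n i) t
    ... | i<μi , not-nested = subst (toℕ i <_) (lookupℕ-toℕ μ i) i<μi , λ { (j , j<i , μi<μj) →
          not-nested (toℕ j) (toℕ<n j) j<i (subst₂ _<_ (sym (lookupℕ-toℕ μ i)) (sym (lookupℕ-toℕ μ j)) μi<μj) }

  exposed-bounds : 1 ≤ n → ∀ μ → IsTL n μ → 1 ≤ exposed n μ × exposed n μ ≤ n
  exposed-bounds (s≤s _) μ tl rewrite exposed≡returns μ tl =
    returns-positive (wordOf μ) (wordOf-valid μ tl) , half (returns-bound 0 (wordOf μ) (wordOf-valid μ tl))
    where
    half : ∀ {r} → r + r + 0 ≤ n + n → r ≤ n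
    half {r} 2r≤2n = ≮⇒≥ (λ n<r → <⇒≱ (+-mono-< n<r n<r) (subst (_≤ n + n) (+-identityʳ (r + r)) 2r≤2n))

  wordOf-injective : ∀ μ ν → IsTL n μ → IsTL n ν → wordOf μ ≡ wordOf ν → μ ≡ ν
  wordOf-injective μ ν tl-μ tl-ν same-word = lookupℕ-injective μ ν
    (opens-injective (IsTL⇒NonCrossingMatching n μ tl-μ) (IsTL⇒NonCrossingMatching n ν tl-ν)
                     (wordFrom-injective (opens (lookupℕ μ)) (opens (lookupℕ ν)) N same-word))

  wordOf-surjective : ∀ w → valid 0 w ≡ true → Σ (Vec (Pos n) N) (λ ν → IsTL n ν × wordOf ν ≡ w)
  wordOf-surjective w w-valid = ν , NonCrossingMatching⇒IsTL n ν ν-matching , wordOf-ν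
    where
    o = isUpAt w
    open Matching N o (trans (cong (valid 0) (wordFrom-isUpAt w)) w-valid)
    ν = tabulateℕ match match-bounded
    ν≗match : ∀ k → k < N → lookupℕ ν k ≡ match k
    ν≗match = lookupℕ-tabulateℕ match match-bounded
    ν-matching : NonCrossingMatching N (lookupℕ ν)
    ν-matching = NonCrossingMatching-cong match-noncrossing ν≗match
    wordOf-ν : wordOf ν ≡ w
    wordOf-ν = trans (wordFrom-cong _ o N (λ k k<N → trans (cong (suc k ≤ᵇ_) (ν≗match k k<N)) (opens-match k k<N)))
                     (wordFrom-isUpAt w)

  ∑-fibre : ∀ w → ∑[ μ ∈ vecs N N ] (𝟙 (does (isTL? n μ)) * 𝟙 (does (wordOf μ ≟ᵥ w))) ≡ 𝟙 (valid 0 w)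
  ∑-fibre w with valid 0 w in w-valid
  ... | false = ∑-zero (vecs N N) (λ μ → 𝟙-does-* (isTL? n μ) (wordOf μ ≟ᵥ w) (no id)
                  (λ tl same → contradiction (trans (sym (wordOf-valid μ tl)) (trans (cong (valid 0) same) w-valid)) (λ ()))
                  (λ ()))
  ... | true with wordOf-surjective w w-valid
  ...   | ν , tl-ν , wordOf-ν = begin
      ∑[ μ ∈ vecs N N ] (𝟙 (does (isTL? n μ)) * 𝟙 (does (wordOf μ ≟ᵥ w)))
    ≡⟨ ∑-cong (vecs N N) (λ μ → 𝟙-does-* (isTL? n μ) (wordOf μ ≟ᵥ w) (μ ≟ᵥ ν)
         (λ tl-μ same → wordOf-injective μ ν tl-μ tl-ν (trans same (sym wordOf-ν)))
         (λ { refl → tl-ν , wordOf-ν })) ⟩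
      ∑[ μ ∈ vecs N N ] 𝟙 (does (μ ≟ᵥ ν))
    ≡⟨ ∑-vecs-point N N ν _ (λ μ μ≢ν → cong 𝟙 (dec-false (μ ≟ᵥ ν) μ≢ν)) ⟩
      𝟙 (does (ν ≟ᵥ ν))
    ≡⟨ cong 𝟙 (dec-true (ν ≟ᵥ ν) refl) ⟩
      1
    ∎

module _ (n d : ℕ) where

  private
    N = n + n
    t = suc d

  tlWeight : Vec (Pos n) N → ℕ
  tlWeight μ = 𝟙 (does (isTL? n μ)) * t ^ returns 0 (wordOf n μ)

  ∑χ≡∑tlWeight : 1 ≤ n → sumFromTo 1 n (λ k → χ k n * (1 + d) ^ k) ≡ ∑ (vecs N N) tlWeight
  ∑χ≡∑tlWeight 1≤n = begin
      sumFromTo 1 n (λ k → χ k n * t ^ k)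
    ≡⟨ trans (sum-map≡∑ (λ i → χ (suc i) n * t ^ suc i) (upTo n)) (∑-upTo n (λ i → χ (suc i) n * t ^ suc i)) ⟩
      ∑[ i < n ] (χ (suc i) n * t ^ suc i)
    ≡⟨ ∑<-cong n (λ i _ → length-filter-×≡∑ (isTL? n) (λ μ → exposed n μ ≟ suc i) (vecs N N) (t ^ suc i)) ⟩
      ∑[ i < n ] ∑[ μ ∈ vecs N N ] (𝟙 (does (isTL? n μ)) * (𝟙 (exposed n μ ≡ᵇ suc i) * t ^ suc i))
    ≡⟨ ∑<-∑-comm n (vecs N N) (λ μ i → 𝟙 (does (isTL? n μ)) * (𝟙 (exposed n μ ≡ᵇ suc i) * t ^ suc i)) ⟩
      ∑[ μ ∈ vecs N N ] ∑[ i < n ] (𝟙 (does (isTL? n μ)) * (𝟙 (exposed n μ ≡ᵇ suc i) * t ^ suc i))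
    ≡⟨ ∑-cong (vecs N N) (λ μ → trans (∑<-distribˡ n (𝟙 (does (isTL? n μ))) (λ i → 𝟙 (exposed n μ ≡ᵇ suc i) * t ^ suc i))
                                       (𝟙-does-guard (isTL? n μ) (exposed-weight μ))) ⟩
      ∑ (vecs N N) tlWeight
    ∎
    where
    exposed-weight : ∀ μ → IsTL n μ → ∑[ i < n ] (𝟙 (exposed n μ ≡ᵇ suc i) * t ^ suc i) ≡ t ^ returns 0 (wordOf n μ)
    exposed-weight μ tl = trans (∑<-indicator-suc n (exposed n μ) (t ^_) 1≤e e≤n) (cong (t ^_) (exposed≡returns n μ tl))
      where
      1≤e = proj₁ (exposed-bounds n 1≤n μ tl)
      e≤n = proj₂ (exposed-bounds n 1≤n μ tl)

  ∑tlWeight≡returnWeighted : ∑ (vecs N N) tlWeight ≡ returnWeighted d N 0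
  ∑tlWeight≡returnWeighted = begin
      ∑[ μ ∈ vecs N N ] (𝟙 (does (isTL? n μ)) * t ^ returns 0 (wordOf n μ))
    ≡⟨ ∑-cong (vecs N N) (λ μ → cong (𝟙 (does (isTL? n μ)) *_) (as-word-sum μ)) ⟩
      ∑[ μ ∈ vecs N N ] (𝟙 (does (isTL? n μ)) * ∑[ w ∈ vecs 2 N ] (𝟙 (does (wordOf n μ ≟ᵥ w)) * t ^ returns 0 w))
    ≡⟨ ∑-cong (vecs N N) (λ μ → sym (trans (∑-cong (vecs 2 N) (λ w → *-assoc (tl μ) (same μ w) (t ^ returns 0 w)))
                                            (∑-distribˡ (vecs 2 N) (tl μ) (λ w → same μ w * t ^ returns 0 w)))) ⟩
      ∑[ μ ∈ vecs N N ] ∑[ w ∈ vecs 2 N ] (tl μ * same μ w * t ^ returns 0 w)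
    ≡⟨ ∑-comm (vecs N N) (vecs 2 N) (λ μ w → tl μ * same μ w * t ^ returns 0 w) ⟩
      ∑[ w ∈ vecs 2 N ] ∑[ μ ∈ vecs N N ] (tl μ * same μ w * t ^ returns 0 w)
    ≡⟨ ∑-cong (vecs 2 N) (λ w → trans (∑-distribʳ (vecs N N) (λ μ → tl μ * same μ w) (t ^ returns 0 w))
                                      (cong (_* t ^ returns 0 w) (∑-fibre n w))) ⟩
      ∑[ w ∈ vecs 2 N ] (𝟙 (valid 0 w) * t ^ returns 0 w)
    ≡⟨ ∑-valid-returns d N 0 ⟩
      returnWeighted d N 0
    ∎
    where
    tl : Vec (Pos n) N → ℕ
    tl μ = 𝟙 (does (isTL? n μ))
    same : Vec (Pos n) N → Word N → ℕ
    same μ w = 𝟙 (does (wordOf n μ ≟ᵥ w))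
    as-word-sum : ∀ μ → t ^ returns 0 (wordOf n μ) ≡ ∑[ w ∈ vecs 2 N ] (same μ w * t ^ returns 0 w)
    as-word-sum μ = sym (begin
        ∑[ w ∈ vecs 2 N ] (same μ w * t ^ returns 0 w)
      ≡⟨ ∑-vecs-point 2 N (wordOf n μ) _ (λ w w≢ →
           cong (λ b → 𝟙 b * t ^ returns 0 w) (dec-false (wordOf n μ ≟ᵥ w) (w≢ ∘ sym))) ⟩
        same μ (wordOf n μ) * t ^ returns 0 (wordOf n μ)
      ≡⟨ cong (λ b → 𝟙 b * t ^ returns 0 (wordOf n μ)) (dec-true (wordOf n μ ≟ᵥ wordOf n μ) refl) ⟩
        1 * t ^ returns 0 (wordOf n μ)
      ≡⟨ *-identityˡ _ ⟩
        t ^ returns 0 (wordOf n μ)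
      ∎)

corollary5p11 : (d n : ℕ) → 1 Data.Nat.≤ d → 1 Data.Nat.≤ n →
    sumFromTo 0 n (λ k → Ω k n * d ^ k) ≡ sumFromTo 1 n (λ k → χ k n * (1 + d) ^ k)
corollary5p11 d n@(suc n′) _ 1≤n = begin
  sumFromTo 0 n (λ k → Ω k n * d ^ k)            ≡⟨ ∑Ω≡∑weightedRows n d ⟩
  ∑[ m < suc n ] weightedRows n d m 0 0          ≡⟨ ∑<-weightedRows≡returnWeighted n′ d ⟩
  returnWeighted d (double n) 0                  ≡⟨ cong (λ L → returnWeighted d L 0) (double≡+ n) ⟩
  returnWeighted d (n + n) 0                     ≡⟨ sym (∑tlWeight≡returnWeighted n d) ⟩
  ∑ (vecs (n + n) (n + n)) (tlWeight n d)        ≡⟨ sym (∑χ≡∑tlWeight n d 1≤n) ⟩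
  sumFromTo 1 n (λ k → χ k n * (1 + d) ^ k)      ∎
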